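{- Let $\mathcal{L}$ be an adequate logic and $T$ an $\mathcal{L}$-theory, and let $G$ be the generic $T$-model in $(\mathcal{C}_T,P_T)$. For every $(\mathcal{C},P)\in\mathrm{Ob}(\mathbf{FA})$ and every $T$-model $S$ in $(\mathcal{C},P)$ there is a morphism $\overline{S}:(\mathcal{C}_T,P_T)\to(\mathcal{C},P)$ in $\mathbf{FA}$ with $\overline{S}(G)=S$, and it is unique up to 2-isomorphism: any morphism $F:(\mathcal{C}_T,P_T)\to(\mathcal{C},P)$ with $F(G)=S$ is 2-isomorphic to $\overline{S}$.
   Context: Syntax and logics: a first-order language $\mathscr{L}$ has quantifier symbols $\mathscr{L}_q$ and connectives $\mathscr{L}_\omega$ with arities (designated $e\in\mathscr{L}_0$, $\otimes\in\mathscr{L}_2$). Signatures: sorts, function symbols $f:\sigma_1..\sigma_n\to\tau$, relation symbols $R\subseteq\sigma_1..\sigma_n$. Contexts $\Gamma=x_1:\sigma_1..x_n:\sigma_n$, terms-in-context, formulas-in-context from $R(\vec M)$, $M_1=_\sigma M_2$, connectives, and $\Omega_{x:\sigma}(\phi)\ [\Gamma]$ from $\phi\ [\Gamma,x:\sigma]$ (up to $\alpha$-equivalence). Assertions: equations-in-context and sequents-in-context $\phi_1..\phi_n\vdash\phi\ [\Gamma]$. A logic assigns to each signature a closure operator $T\mapsto T_{\mathcal{L}}$ on theories (sets of assertions) satisfying typed equational logic; $T$ is an $\mathcal{L}$-theory if $T=T_{\mathcal{L}}$. $\mathrm{Ob}(\mathbf{FA})$: prop-categories $(\mathcal{C},P)$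 ($\mathcal{C}$ with designated finite products, $P:\mathcal{C}^{op}\to\mathbf{Pos}$) with $\mathscr{L}_\omega$-algebra structures on each $P(c)$ preserved by $P(f)$, elements $Eq_c\in P(c\times c)$, maps $\Omega_{b,c}:P(b\times c)\to P(b)$ natural in $b$, such that $(P(c),\otimes,e_c)$ is a monoid, $\Omega_{b,1}\circ P(\pi_1^{b,1})=\mathrm{id}$, $\Omega_{b,c\times d}\circ P(a_{b,c,d})=\Omega_{b,c}\circ\Omega_{b\times c,d}$ (canonical associator $a$), $Eq_1=e_{1\times1}$, $Eq_{c_1\times c_2}=P(\langle\pi_1^{c_1,c_2}\pi_1,\pi_1^{c_1,c_2}\pi_2\rangle)(Eq_{c_1})\otimes P(\langle\pi_2^{c_1,c_2}\pi_1,\pi_2^{c_1,c_2}\pi_2\rangle)(Eq_{c_2})$. Structures: an $Sg$-structure assigns objects to sorts, morphisms to function symbols, elements of $P(\text{product})$ to relation symbols, and interprets terms as morphisms and formulas as elements of $P([\![\Gamma]\!])$ ($[\![R(\vec M)]\!]=P(\langle[\![M_i]\!]\rangle)[\![R]\!]$, $[\![M_1=_\tau M_2]\!]=P(\langle[\![M_1]\!],[\![M_2]\!]\rangle)Eq_{[\![\tau]\!]}$, connectives pointwise, $[\![\Omega_{x:\sigma}\phi[\Gamma]]\!]=\Omega_{[\![\Gamma]\!],[\![\sigma]\!]}(P(a)[\![\phi[\Gamma,x:\sigma]]\!])$). It satisfies an equation if both sides agree and a sequent if $\bigotimes[\![\phi_i]\!]\le[\![\phi]\!]$ (empty $\otimes$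 is $e$); a $T$-model satisfies all of $T$. Morphisms $F:(\mathcal{C},P)\to(\mathcal{D},Q)$: finite-product-preserving $F^o$ and natural $F^p:P\Rightarrow QF^o$ with each $F^p_c$ an $\mathscr{L}_\omega$-homomorphism, $F^p_b\Omega_{b,c}=\Omega_{F^ob,F^oc}Q(a_{F,b,c}^{ -1})F^p_{b\times c}$, $F^p_{c\times c}(Eq_c)=Q(a_{F,c,c})(Eq_{F^oc})$ ($a_{F,b,c}:F^o(b\times c)\to F^ob\times F^oc$ canonical). A 2-cell $\eta:F\Rightarrow H$ is a natural transformation $\eta:F^o\Rightarrow H^o$ with $F^p_c=Q(\eta_c)\circ H^p_c$; a 2-isomorphism if $\eta$ is a natural isomorphism. For a structure $S$ in $(\mathcal{C},P)$, $F(S)$ is the structure in $(\mathcal{D},Q)$ with $F(S)[\![\sigma]\!]=F^oS[\![\sigma]\!]$, $F(S)[\![f]\!]=F^o(S[\![f]\!])\circ a_\Gamma^{ -1}$, $F(S)[\![R]\!]=Q(a_\Gamma^{ -1})(F^p_{S[\![\Gamma]\!]}S[\![R]\!])$, where $a_\Gamma:F^o(S[\![\Gamma]\!])\to F(S)[\![\Gamma]\!]$ is canonical. Classifying prop-category $(\mathcal{C}_T,P_T)$: objects contexts (up to renaming); morphisms $\Gamma'\to x_1:\sigma_1..x_n:\sigma_n$ are lists $[N_1..N_n]$ of terms $N_i:\sigma_i\ [\Gamma']$ modulo equality in $T$; composition by substitution; products by concatenation; $P_T(\Gamma)$ = formulas in $[\Gamma]$ modulo mutual derivability in $T$, ordered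 by $\phi\vdash\psi\ [\Gamma]\in T$; action by simultaneous substitution; connectives on representatives; $\Omega_{\Gamma,\Gamma'}[\phi]=[\Omega_{y_1:\tau_1}\cdots\Omega_{y_m:\tau_m}\phi]$; $Eq_\Gamma=[x_1=_{\sigma_1}x_1'\otimes\dots\otimes x_n=_{\sigma_n}x_n']$, $Eq_{[\,]}=[e]$. $\mathcal{L}$ is adequate if for each $\mathcal{L}$-theory these data are well defined and lie in $\mathrm{Ob}(\mathbf{FA})$. The generic model $G$: $G[\![\sigma]\!]$ = context $x:\sigma$, $G[\![f]\!]=[f(x_1..x_n)]$ and $G[\![R]\!]=[R(x_1..x_n)\ [x_1:\sigma_1..x_n:\sigma_n]]$. -}

module Defs where

open import Level using (Level; _⊔_; 0ℓ) renaming (suc to lsuc)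
open import Data.Nat using (ℕ)
open import Data.Unit using (⊤)
open import Data.Vec using (Vec; []; _∷_)
import Data.Vec as Vec
open import Data.Vec.Relation.Binary.Pointwise.Inductive using (Pointwise)
open import Data.List using (List; []; _∷_; foldl)
import Data.List as List
open import Data.Product using (Σ; _×_; _,_)
open import Relation.Binary.PropositionalEquality using (_≡_; refl; subst; subst₂; cong₂)

record Language : Set₁ where
  field
    Quant  : Set
    Conn   : ℕ → Set
    eConn  : Conn 0
    tensor : Conn 2

-- Contexts / arities as snoc lists (de Bruijn: contexts up to renaming,
-- formulas up to α-equivalence). x₁:σ₁ … xₙ:σₙ is ((ε ▷ σ₁) ▷ …) ▷ σₙ.

infixl 5 _▷_
data Ctx (S : Set) : Set where
  ε   : Ctx S
  _▷_ : Ctx S → S → Ctx S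

infix 4 _∋_
data _∋_ {S : Set} : Ctx S → S → Set where
  here  : ∀ {Γ σ} → (Γ ▷ σ) ∋ σ
  there : ∀ {Γ σ τ} → Γ ∋ σ → (Γ ▷ τ) ∋ σ

infixl 5 _++_
_++_ : {S : Set} → Ctx S → Ctx S → Ctx S
Γ ++ ε = Γ
Γ ++ (Δ ▷ σ) = (Γ ++ Δ) ▷ σ

wkL : {S : Set} {Γ Δ : Ctx S} {σ : S} → Γ ∋ σ → (Γ ++ Δ) ∋ σ
wkL {Δ = ε} x = x
wkL {Δ = Δ ▷ τ} x = there (wkL {Δ = Δ} x)

wkR : {S : Set} {Γ Δ : Ctx S} {σ : S} → Δ ∋ σ → (Γ ++ Δ) ∋ σ
wkR here = here
wkR (there x) = there (wkR x)

record Signature : Set₁ where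
  field
    Sort : Set
    Fun  : Ctx Sort → Sort → Set
    Rel  : Ctx Sort → Set

module Syntax (ℒ : Language) (Sg : Signature) where
  open Language ℒ
  open Signature Sg

  Cx : Set
  Cx = Ctx Sort

  mutual
    data Tm (Γ : Cx) : Sort → Set where
      var : ∀ {σ} → Γ ∋ σ → Tm Γ σ
      app : ∀ {Δ τ} → Fun Δ τ → Tms Γ Δ → Tm Γ τ

    data Tms (Γ : Cx) : Cx → Set where
      ε   : Tms Γ ε
      _,_ : ∀ {Δ σ} → Tms Γ Δ → Tm Γ σ → Tms Γ (Δ ▷ σ)

  data Fm : Cx → Set where
    rel   : ∀ {Γ Δ} → Rel Δ → Tms Γ Δ → Fm Γ
    eq    : ∀ {Γ} (σ : Sort) → Tm Γ σ → Tm Γ σ → Fm Γ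
    conn  : ∀ {Γ n} → Conn n → Vec (Fm Γ) n → Fm Γ
    quant : ∀ {Γ} → Quant → (σ : Sort) → Fm (Γ ▷ σ) → Fm Γ

  mutual
    renT : ∀ {Γ Δ σ} → (∀ {τ} → Δ ∋ τ → Γ ∋ τ) → Tm Δ σ → Tm Γ σ
    renT r (var x) = var (r x)
    renT r (app f ts) = app f (renTs r ts)

    renTs : ∀ {Γ Δ Θ} → (∀ {τ} → Δ ∋ τ → Γ ∋ τ) → Tms Δ Θ → Tms Γ Θ
    renTs r ε = ε
    renTs r (ts , t) = renTs r ts , renT r t

  wkS : ∀ {Γ Δ σ} → Tms Γ Δ → Tms (Γ ▷ σ) Δ
  wkS = renTs there

  tab : ∀ {Γ Δ} → (∀ {σ} → Δ ∋ σ → Tm Γ σ) → Tms Γ Δ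
  tab {Δ = ε} f = ε
  tab {Δ = Δ ▷ σ} f = tab (λ x → f (there x)) , f here

  lookup : ∀ {Γ Δ σ} → Tms Γ Δ → Δ ∋ σ → Tm Γ σ
  lookup (ts , t) here = t
  lookup (ts , t) (there x) = lookup ts x

  mutual
    subT : ∀ {Γ Δ σ} → Tms Γ Δ → Tm Δ σ → Tm Γ σ
    subT ρ (var x) = lookup ρ x
    subT ρ (app f ts) = app f (subTs ρ ts)

    subTs : ∀ {Γ Δ Θ} → Tms Γ Δ → Tms Δ Θ → Tms Γ Θ
    subTs ρ ε = ε
    subTs ρ (ts , t) = subTs ρ ts , subT ρ t

  lift : ∀ {Γ Δ σ} → Tms Γ Δ → Tms (Γ ▷ σ) (Δ ▷ σ)
  lift ρ = wkS ρ , var here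

  mutual
    subF : ∀ {Γ Δ} → Tms Γ Δ → Fm Δ → Fm Γ
    subF ρ (rel R ts) = rel R (subTs ρ ts)
    subF ρ (eq σ M N) = eq σ (subT ρ M) (subT ρ N)
    subF ρ (conn c φs) = conn c (subFs ρ φs)
    subF ρ (quant q σ φ) = quant q σ (subF (lift ρ) φ)

    subFs : ∀ {Γ Δ n} → Tms Γ Δ → Vec (Fm Δ) n → Vec (Fm Γ) n
    subFs ρ [] = []
    subFs ρ (φ ∷ φs) = subF ρ φ ∷ subFs ρ φs

  eF : ∀ {Γ} → Fm Γ
  eF = conn eConn []

  _⊗F_ : ∀ {Γ} → Fm Γ → Fm Γ → Fm Γ
  φ ⊗F ψ = conn tensor (φ ∷ ψ ∷ [])

  bigF : ∀ {Γ} → List (Fm Γ) → Fm Γ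
  bigF [] = eF
  bigF (φ ∷ φs) = foldl _⊗F_ φ φs

  data Assertion : Set where
    eqn  : (Γ : Cx) (σ : Sort) → Tm Γ σ → Tm Γ σ → Assertion
    seqt : (Γ : Cx) → List (Fm Γ) → Fm Γ → Assertion

  Theory : Set₁
  Theory = Assertion → Set

  TmsEq : Theory → ∀ {Γ Δ} → Tms Γ Δ → Tms Γ Δ → Set
  TmsEq T ε ε = ⊤
  TmsEq T {Γ} (_,_ {σ = σ} ρ t) (ρ' , t') = TmsEq T ρ ρ' × T (eqn Γ σ t t')

  record ClosureOperator : Set₁ where
    field
      Cl         : Theory → Theory
      extensive  : ∀ T A → T A → Cl T A
      monotone   : ∀ T U → (∀ A → T A → U A) → ∀ A → Cl T A → Cl U A
      idempotent : ∀ T A → Cl (Cl T) A → Cl T A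
      eq-refl    : ∀ T Γ σ (M : Tm Γ σ) → Cl T (eqn Γ σ M M)
      eq-sym     : ∀ T Γ σ (M N : Tm Γ σ) → Cl T (eqn Γ σ M N) → Cl T (eqn Γ σ N M)
      eq-trans   : ∀ T Γ σ (M N K : Tm Γ σ) → Cl T (eqn Γ σ M N) → Cl T (eqn Γ σ N K)
                   → Cl T (eqn Γ σ M K)
      eq-subst   : ∀ T Γ Δ σ (M N : Tm Δ σ) (ρ ρ' : Tms Γ Δ) → Cl T (eqn Δ σ M N)
                   → TmsEq (Cl T) ρ ρ' → Cl T (eqn Γ σ (subT ρ M) (subT ρ' N))

  idS : ∀ {Γ} → Tms Γ Γ
  idS = tab var

  π₁S : ∀ {Γ Δ} → Tms (Γ ++ Δ) Γ
  π₁S {Δ = Δ} = tab (λ x → var (wkL {Δ = Δ} x))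

  π₂S : ∀ {Γ Δ} → Tms (Γ ++ Δ) Δ
  π₂S = tab (λ x → var (wkR x))

  pairS : ∀ {Θ Γ Δ} → Tms Θ Γ → Tms Θ Δ → Tms Θ (Γ ++ Δ)
  pairS f ε = f
  pairS f (g , t) = pairS f g , t

  allVars : (Γ : Cx) → List (Σ Sort (λ σ → Γ ∋ σ))
  allVars ε = []
  allVars (Γ ▷ σ) = List.map (λ { (τ , x) → τ , there x }) (allVars Γ) List.++ ((σ , here) ∷ [])

  eqFm : (Γ : Cx) → Fm (Γ ++ Γ)
  eqFm Γ = bigF (List.map (λ { (σ , x) → eq σ (var (wkL {Δ = Γ} x)) (var (wkR x)) }) (allVars Γ))

  quantAll : Quant → ∀ {Γ} (Γ' : Cx) → Fm (Γ ++ Γ') → Fm Γ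
  quantAll q ε φ = φ
  quantAll q (Γ' ▷ τ) φ = quantAll q Γ' (quant q τ φ)

Logic : Language → Set₁
Logic ℒ = (Sg : Signature) → Syntax.ClosureOperator ℒ Sg

IsLTheory : (ℒ : Language) → Logic ℒ → (Sg : Signature) → Syntax.Theory ℒ Sg → Set
IsLTheory ℒ L Sg T = ∀ A → (T A → Cl T A) × (Cl T A → T A)
  where open Syntax.ClosureOperator (L Sg)

-- Prop-categories with the structure of Ob(FA)
-- Hom-sets are setoids (_≈_); P(c) is a preorder whose poset quotient
-- (x ≃ y iff x ≤ y and y ≤ x) is the poset P(c).

record RawFA (ℒ : Language) (o h e p r : Level) : Set (lsuc (o ⊔ h ⊔ e ⊔ p ⊔ r)) where
  open Language ℒ
  infix 4 _≈_ _≤_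
  infixr 9 _∘_
  infixr 7 _⊠_
  field
    Obj   : Set o
    Hom   : Obj → Obj → Set h
    _≈_   : ∀ {a b} → Hom a b → Hom a b → Set e
    id    : ∀ {a} → Hom a a
    _∘_   : ∀ {a b c} → Hom b c → Hom a b → Hom a c
    𝟙     : Obj
    !     : ∀ {a} → Hom a 𝟙
    _⊠_   : Obj → Obj → Obj
    π₁    : ∀ {a b} → Hom (a ⊠ b) a
    π₂    : ∀ {a b} → Hom (a ⊠ b) b
    ⟨_,_⟩ : ∀ {c a b} → Hom c a → Hom c b → Hom c (a ⊠ b)
    P     : Obj → Set p
    _≤_   : ∀ {c} → P c → P c → Set r
    Pmap  : ∀ {b c} → Hom b c → P c → P b
    op    : ∀ {c n} → Conn n → Vec (P c) n → P c
    Eq    : ∀ c → P (c ⊠ c)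
    Ω     : Quant → ∀ b c → P (b ⊠ c) → P b

  infix 4 _≃_
  _≃_ : ∀ {c} → P c → P c → Set r
  x ≃ y = (x ≤ y) × (y ≤ x)

  _⊠m_ : ∀ {a b c d} → Hom a b → Hom c d → Hom (a ⊠ c) (b ⊠ d)
  f ⊠m g = ⟨ f ∘ π₁ , g ∘ π₂ ⟩

  assocM : ∀ {b c d} → Hom (b ⊠ (c ⊠ d)) ((b ⊠ c) ⊠ d)
  assocM = ⟨ ⟨ π₁ , π₁ ∘ π₂ ⟩ , π₂ ∘ π₂ ⟩

  eP : ∀ {c} → P c
  eP = op eConn []

  _⊗P_ : ∀ {c} → P c → P c → P c
  x ⊗P y = op tensor (x ∷ y ∷ [])

  bigP : ∀ {c} → List (P c) → P c
  bigP [] = eP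
  bigP (x ∷ xs) = foldl _⊗P_ x xs

record IsFA {ℒ : Language} {o h e p r : Level} (X : RawFA ℒ o h e p r)
       : Set (o ⊔ h ⊔ e ⊔ p ⊔ r) where
  open Language ℒ
  open RawFA X
  field
    ≈-refl    : ∀ {a b} {f : Hom a b} → f ≈ f
    ≈-sym     : ∀ {a b} {f g : Hom a b} → f ≈ g → g ≈ f
    ≈-trans   : ∀ {a b} {f g k : Hom a b} → f ≈ g → g ≈ k → f ≈ k
    ∘-resp    : ∀ {a b c} {f f' : Hom b c} {g g' : Hom a b} → f ≈ f' → g ≈ g' → f ∘ g ≈ f' ∘ g'
    idˡ       : ∀ {a b} (f : Hom a b) → id ∘ f ≈ f
    idʳ       : ∀ {a b} (f : Hom a b) → f ∘ id ≈ f
    ∘-assoc   : ∀ {a b c d} (f : Hom c d) (g : Hom b c) (k : Hom a b) → (f ∘ g) ∘ k ≈ f ∘ (g ∘ k)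
    !-unique  : ∀ {a} (f : Hom a 𝟙) → f ≈ !
    π₁-β      : ∀ {c a b} (f : Hom c a) (g : Hom c b) → π₁ ∘ ⟨ f , g ⟩ ≈ f
    π₂-β      : ∀ {c a b} (f : Hom c a) (g : Hom c b) → π₂ ∘ ⟨ f , g ⟩ ≈ g
    ⟨⟩-unique : ∀ {c a b} (f : Hom c a) (g : Hom c b) (k : Hom c (a ⊠ b))
                → π₁ ∘ k ≈ f → π₂ ∘ k ≈ g → k ≈ ⟨ f , g ⟩
    ≤-refl    : ∀ {c} {x : P c} → x ≤ x
    ≤-trans   : ∀ {c} {x y z : P c} → x ≤ y → y ≤ z → x ≤ z
    Pmap-mono : ∀ {b c} (f : Hom b c) {x y : P c} → x ≤ y → Pmap f x ≤ Pmap f y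
    Pmap-resp : ∀ {b c} {f g : Hom b c} → f ≈ g → ∀ x → Pmap f x ≃ Pmap g x
    Pmap-id   : ∀ {c} (x : P c) → Pmap id x ≃ x
    Pmap-∘    : ∀ {a b c} (g : Hom b c) (f : Hom a b) (x : P c) → Pmap (g ∘ f) x ≃ Pmap f (Pmap g x)
    op-resp   : ∀ {c n} (k : Conn n) {xs ys : Vec (P c) n} → Pointwise _≃_ xs ys → op k xs ≃ op k ys
    op-nat    : ∀ {b c n} (k : Conn n) (f : Hom b c) (xs : Vec (P c) n)
                → Pmap f (op k xs) ≃ op k (Vec.map (Pmap f) xs)
    ⊗-assoc   : ∀ {c} (x y z : P c) → (x ⊗P y) ⊗P z ≃ x ⊗P (y ⊗P z)
    ⊗-idˡ     : ∀ {c} (x : P c) → eP ⊗P x ≃ x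
    ⊗-idʳ     : ∀ {c} (x : P c) → x ⊗P eP ≃ x
    Ω-resp    : ∀ q b c {x y : P (b ⊠ c)} → x ≃ y → Ω q b c x ≃ Ω q b c y
    Ω-nat     : ∀ q {b' b} c (f : Hom b' b) (x : P (b ⊠ c))
                → Pmap f (Ω q b c x) ≃ Ω q b' c (Pmap (f ⊠m id) x)
    Ω-unit    : ∀ q b (x : P b) → Ω q b 𝟙 (Pmap (π₁ {b} {𝟙}) x) ≃ x
    Ω-assoc   : ∀ q b c d (x : P ((b ⊠ c) ⊠ d))
                → Ω q b (c ⊠ d) (Pmap (assocM {b} {c} {d}) x) ≃ Ω q b c (Ω q (b ⊠ c) d x)
    Eq-𝟙      : Eq 𝟙 ≃ eP
    Eq-⊠      : ∀ c₁ c₂ → Eq (c₁ ⊠ c₂) ≃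
                  (Pmap ⟨ π₁ {c₁} {c₂} ∘ π₁ , π₁ {c₁} {c₂} ∘ π₂ ⟩ (Eq c₁)
                   ⊗P Pmap ⟨ π₂ {c₁} {c₂} ∘ π₁ , π₂ {c₁} {c₂} ∘ π₂ ⟩ (Eq c₂))

record FA (ℒ : Language) (o h e p r : Level) : Set (lsuc (o ⊔ h ⊔ e ⊔ p ⊔ r)) where
  field
    raw  : RawFA ℒ o h e p r
    laws : IsFA raw
  open RawFA raw public

module Interp (ℒ : Language) (Sg : Signature) {o h e p r : Level} (X : RawFA ℒ o h e p r) where
  open Signature Sg
  open RawFA X
  open Syntax ℒ Sg

  ctxObj : (Sort → Obj) → Cx → Obj
  ctxObj I ε = 𝟙
  ctxObj I (ε ▷ σ) = I σ
  ctxObj I (Γ ▷ τ ▷ σ) = ctxObj I (Γ ▷ τ) ⊠ I σ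

  ctxObj-cong : {I J : Sort → Obj} → (∀ σ → I σ ≡ J σ) → ∀ Γ → ctxObj I Γ ≡ ctxObj J Γ
  ctxObj-cong p ε = refl
  ctxObj-cong p (ε ▷ σ) = p σ
  ctxObj-cong p (Γ ▷ τ ▷ σ) = cong₂ _⊠_ (ctxObj-cong p (Γ ▷ τ)) (p σ)

  record Structure : Set (o ⊔ h ⊔ p) where
    field
      sortI : Sort → Obj
      funI  : ∀ {Δ τ} → Fun Δ τ → Hom (ctxObj sortI Δ) (sortI τ)
      relI  : ∀ {Δ} → Rel Δ → P (ctxObj sortI Δ)

  module _ (S : Structure) where
    open Structure S

    ⟦_⟧c : Cx → Obj
    ⟦ Γ ⟧c = ctxObj sortI Γ

    varI : ∀ {Γ σ} → Γ ∋ σ → Hom ⟦ Γ ⟧c (sortI σ)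
    varI {ε ▷ σ} here = id
    varI {Γ ▷ τ ▷ σ} here = π₂
    varI {Γ ▷ τ ▷ σ} (there x) = varI x ∘ π₁

    canon : ∀ Γ σ → Hom (⟦ Γ ⟧c ⊠ sortI σ) ⟦ Γ ▷ σ ⟧c
    canon ε σ = π₂
    canon (Γ ▷ τ) σ = id

    mutual
      tmI : ∀ {Γ σ} → Tm Γ σ → Hom ⟦ Γ ⟧c (sortI σ)
      tmI (var x) = varI x
      tmI (app f ts) = funI f ∘ tmsI ts

      tmsI : ∀ {Γ Δ} → Tms Γ Δ → Hom ⟦ Γ ⟧c ⟦ Δ ⟧c
      tmsI ε = !
      tmsI (ε , t) = tmI t
      tmsI ((ts , s) , t) = ⟨ tmsI (ts , s) , tmI t ⟩

    mutual
      fmI : ∀ {Γ} → Fm Γ → P ⟦ Γ ⟧c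
      fmI (rel R ts) = Pmap (tmsI ts) (relI R)
      fmI (eq σ M N) = Pmap ⟨ tmI M , tmI N ⟩ (Eq (sortI σ))
      fmI (conn k φs) = op k (fmIs φs)
      fmI {Γ} (quant q σ φ) = Ω q ⟦ Γ ⟧c (sortI σ) (Pmap (canon Γ σ) (fmI φ))

      fmIs : ∀ {Γ n} → Vec (Fm Γ) n → Vec (P ⟦ Γ ⟧c) n
      fmIs [] = []
      fmIs (φ ∷ φs) = fmI φ ∷ fmIs φs

    Satisfies : Assertion → Set (e ⊔ r)
    Satisfies (eqn Γ σ M N) = Level.Lift r (tmI M ≈ tmI N)
    Satisfies (seqt Γ φs φ) = Level.Lift e (bigP (List.map fmI φs) ≤ fmI φ)

    IsModel : Theory → Set (e ⊔ r)
    IsModel T = ∀ A → T A → Satisfies A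

  record StrEq (S S' : Structure) : Set (o ⊔ e ⊔ r) where
    open Structure
    field
      sortEq : ∀ σ → sortI S σ ≡ sortI S' σ
      funEq  : ∀ {Δ τ} (f : Fun Δ τ) →
               subst₂ Hom (ctxObj-cong sortEq Δ) (sortEq τ) (funI S f) ≈ funI S' f
      relEq  : ∀ {Δ} (R : Rel Δ) →
               subst P (ctxObj-cong sortEq Δ) (relI S R) ≃ relI S' R

record FAMor {ℒ : Language} {o h e p r o' h' e' p' r' : Level}
             (X : FA ℒ o h e p r) (Y : FA ℒ o' h' e' p' r')
             : Set (o ⊔ h ⊔ e ⊔ p ⊔ r ⊔ o' ⊔ h' ⊔ e' ⊔ p' ⊔ r') where
  private
    module X = FA X
    module Y = FA Y
  field
    Fo      : X.Obj → Y.Obj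
    Fh      : ∀ {a b} → X.Hom a b → Y.Hom (Fo a) (Fo b)
    Fh-resp : ∀ {a b} {f g : X.Hom a b} → f X.≈ g → Fh f Y.≈ Fh g
    Fh-id   : ∀ {a} → Fh (X.id {a}) Y.≈ Y.id
    Fh-∘    : ∀ {a b c} (g : X.Hom b c) (f : X.Hom a b) → Fh (g X.∘ f) Y.≈ (Fh g Y.∘ Fh f)
    𝟙-inv   : Y.Hom Y.𝟙 (Fo X.𝟙)
    𝟙-iso₁  : (𝟙-inv Y.∘ Y.!) Y.≈ Y.id
    𝟙-iso₂  : (Y.! Y.∘ 𝟙-inv) Y.≈ Y.id
    ×-inv   : ∀ {a b} → Y.Hom (Fo a Y.⊠ Fo b) (Fo (a X.⊠ b))
    ×-iso₁  : ∀ {a b} → (×-inv Y.∘ Y.⟨ Fh (X.π₁ {a} {b}) , Fh (X.π₂ {a} {b}) ⟩) Y.≈ Y.id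
    ×-iso₂  : ∀ {a b} → (Y.⟨ Fh (X.π₁ {a} {b}) , Fh (X.π₂ {a} {b}) ⟩ Y.∘ ×-inv) Y.≈ Y.id
    Fp      : ∀ {c} → X.P c → Y.P (Fo c)
    Fp-mono : ∀ {c} {x y : X.P c} → x X.≤ y → Fp x Y.≤ Fp y
    Fp-nat  : ∀ {b c} (f : X.Hom b c) (x : X.P c) → Fp (X.Pmap f x) Y.≃ Y.Pmap (Fh f) (Fp x)
    Fp-op   : ∀ {c n} (k : Language.Conn ℒ n) (xs : Vec (X.P c) n)
              → Fp (X.op k xs) Y.≃ Y.op k (Vec.map Fp xs)
    Fp-Ω    : ∀ q b c (x : X.P (b X.⊠ c))
              → Fp (X.Ω q b c x) Y.≃ Y.Ω q (Fo b) (Fo c) (Y.Pmap ×-inv (Fp x))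
    Fp-Eq   : ∀ c → Fp (X.Eq c) Y.≃ Y.Pmap Y.⟨ Fh (X.π₁ {c} {c}) , Fh (X.π₂ {c} {c}) ⟩ (Y.Eq (Fo c))

record TwoIso {ℒ : Language} {o h e p r o' h' e' p' r' : Level}
              {X : FA ℒ o h e p r} {Y : FA ℒ o' h' e' p' r'} (F H : FAMor X Y)
              : Set (o ⊔ h ⊔ p ⊔ h' ⊔ e' ⊔ r') where
  private
    module X = FA X
    module Y = FA Y
    module F = FAMor F
    module H = FAMor H
  field
    η      : ∀ c → Y.Hom (F.Fo c) (H.Fo c)
    η-nat  : ∀ {a b} (f : X.Hom a b) → (η b Y.∘ F.Fh f) Y.≈ (H.Fh f Y.∘ η a)
    η-p    : ∀ {c} (x : X.P c) → F.Fp x Y.≃ Y.Pmap (η c) (H.Fp x)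
    η-inv  : ∀ c → Y.Hom (H.Fo c) (F.Fo c)
    η-iso₁ : ∀ c → (η-inv c Y.∘ η c) Y.≈ Y.id
    η-iso₂ : ∀ c → (η c Y.∘ η-inv c) Y.≈ Y.id

applyS : {ℒ : Language} {Sg : Signature} {o h e p r o' h' e' p' r' : Level}
         {X : FA ℒ o h e p r} {Y : FA ℒ o' h' e' p' r'} (F : FAMor X Y)
         → Interp.Structure ℒ Sg (FA.raw X) → Interp.Structure ℒ Sg (FA.raw Y)
applyS {ℒ} {Sg} {X = X} {Y} F S = record
  { sortI = λ σ → Fo (sortI σ)
  ; funI  = λ {Δ} f → Fh (funI f) Y.∘ aInv Δ
  ; relI  = λ {Δ} R → Y.Pmap (aInv Δ) (Fp (relI R))
  }
  where
    module X = FA X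
    module Y = FA Y
    open FAMor F
    open Signature Sg
    open Interp.Structure S
    module IX = Interp ℒ Sg (FA.raw X)
    module IY = Interp ℒ Sg (FA.raw Y)
    aInv : ∀ Γ → Y.Hom (IY.ctxObj (λ σ → Fo (sortI σ)) Γ) (Fo (IX.ctxObj sortI Γ))
    aInv ε = 𝟙-inv
    aInv (ε ▷ σ) = Y.id
    aInv (Γ ▷ τ ▷ σ) = ×-inv Y.∘ (aInv (Γ ▷ τ) Y.⊠m Y.id)

module Classifying (ℒ : Language) (Sg : Signature) where
  open Syntax ℒ Sg

  rawCT : Theory → RawFA ℒ 0ℓ 0ℓ 0ℓ 0ℓ 0ℓ
  rawCT T = record
    { Obj   = Cx
    ; Hom   = Tms
    ; _≈_   = TmsEq T
    ; id    = idS
    ; _∘_   = λ g f → subTs f g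
    ; 𝟙     = ε
    ; !     = ε
    ; _⊠_   = _++_
    ; π₁    = λ {Γ} {Δ} → π₁S {Γ} {Δ}
    ; π₂    = π₂S
    ; ⟨_,_⟩ = pairS
    ; P     = Fm
    ; _≤_   = λ {Γ} φ ψ → T (seqt Γ (φ ∷ []) ψ)
    ; Pmap  = subF
    ; op    = conn
    ; Eq    = eqFm
    ; Ω     = λ q Γ Γ' φ → quantAll q Γ' φ
    }

Adequate : (ℒ : Language) → Logic ℒ → Set₁
Adequate ℒ L = ∀ (Sg : Signature) (T : Syntax.Theory ℒ Sg) → IsLTheory ℒ L Sg T
               → IsFA (Classifying.rawCT ℒ Sg T)

CT : (ℒ : Language) (L : Logic ℒ) → Adequate ℒ L → (Sg : Signature) (T : Syntax.Theory ℒ Sg)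
     → IsLTheory ℒ L Sg T → FA ℒ 0ℓ 0ℓ 0ℓ 0ℓ 0ℓ
CT ℒ L adq Sg T isT = record { raw = Classifying.rawCT ℒ Sg T ; laws = adq Sg T isT }

generic : (ℒ : Language) (Sg : Signature) (T : Syntax.Theory ℒ Sg)
          → Interp.Structure ℒ Sg (Classifying.rawCT ℒ Sg T)
generic ℒ Sg T = record
  { sortI = sortG
  ; funI  = λ {Δ} f → ε , app f (vars Δ)
  ; relI  = λ {Δ} R → rel R (vars Δ)
  }
  where
    open Syntax ℒ Sg
    open Signature Sg
    module I = Interp ℒ Sg (Classifying.rawCT ℒ Sg T)
    sortG : Sort → Cx
    sortG σ = ε ▷ σ
    -- the variables x₁ … xₙ of the context [[Δ]] (which is Δ up to renaming)
    vars : (Δ : Cx) → Tms (I.ctxObj sortG Δ) Δ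
    vars ε = ε
    vars (ε ▷ σ) = ε , var here
    vars (Δ ▷ τ ▷ σ) = wkS (vars (Δ ▷ τ)) , var here

-- S̄ is the interpretation functor: a context goes to the product of its sorts, a list of terms
-- to the tuple of their interpretations, a formula to its interpretation in P.  Soundness of the
-- model makes this well defined on T-classes, the substitution lemma makes it a functor with
-- natural F^p, and once ⟦Γ ++ Δ⟧ ≅ ⟦Γ⟧ × ⟦Δ⟧ is in place the clauses for Ω_{Γ,Δ} and Eq_Γ are
-- exactly Ω-assoc/Ω-unit and Eq-⊠ unfolded along the context.
-- For uniqueness, every context of C_T is the product of its one-variable contexts, and F(G) = S
-- fixes F(x:σ) = S⟦σ⟧.  The images under F of the variable projections therefore assemble into
-- η_Γ : F(Γ) → ⟦Γ⟧, an isomorphism since F preserves products; naturality of η and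
-- F^p ≃ P(η) ∘ ⟦−⟧ follow by induction on terms and formulas, the base cases being F(G) = S on
-- function and relation symbols.

module Submission where

open import Defs
open import Level using (Level; lower)
open import Data.Product using (Σ; _×_; _,_; proj₁; proj₂)
open import Data.Sum using (_⊎_; inj₁; inj₂)
import Data.Sum as Sum
open import Data.List using (List; []; _∷_; foldl)
import Data.List as List
import Data.List.Properties as List
open import Data.Vec using (Vec; []; _∷_)
import Data.Vec as Vec
open import Data.Vec.Relation.Binary.Pointwise.Inductive using (Pointwise; []; _∷_)
open import Relation.Binary.Bundles using (Setoid)
open import Relation.Binary.PropositionalEquality
  using (_≡_; refl; sym; trans; cong; cong₂; subst; subst₂; module ≡-Reasoning)
import Relation.Binary.Reasoning.MultiSetoid as MultiSetoidReasoning

module FAProperties {ℒ : Language} {o h e p r : Level} (X : FA ℒ o h e p r) where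
  open FA X public
  open IsFA (FA.laws X) public
  open Language ℒ
  open MultiSetoidReasoning

  homSetoid : ∀ {a b} → Setoid h e
  homSetoid {a} {b} = record
    { Carrier = Hom a b ; _≈_ = _≈_
    ; isEquivalence = record { refl = ≈-refl ; sym = ≈-sym ; trans = ≈-trans } }

  ≃-refl : ∀ {c} {x : P c} → x ≃ x
  ≃-refl = ≤-refl , ≤-refl

  ≃-sym : ∀ {c} {x y : P c} → x ≃ y → y ≃ x
  ≃-sym (x≤y , y≤x) = y≤x , x≤y

  ≃-trans : ∀ {c} {x y z : P c} → x ≃ y → y ≃ z → x ≃ z
  ≃-trans (x≤y , y≤x) (y≤z , z≤y) = ≤-trans x≤y y≤z , ≤-trans z≤y y≤x

  predSetoid : ∀ {c} → Setoid p r
  predSetoid {c} = record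
    { Carrier = P c ; _≈_ = _≃_
    ; isEquivalence = record { refl = ≃-refl ; sym = ≃-sym ; trans = ≃-trans } }

  ≡⇒≈ : ∀ {a b} {f g : Hom a b} → f ≡ g → f ≈ g
  ≡⇒≈ refl = ≈-refl

  ≡⇒≃ : ∀ {c} {x y : P c} → x ≡ y → x ≃ y
  ≡⇒≃ refl = ≃-refl

  refl⟩∘⟨_ : ∀ {a b c} {f : Hom b c} {g g′ : Hom a b} → g ≈ g′ → f ∘ g ≈ f ∘ g′
  refl⟩∘⟨ g≈g′ = ∘-resp ≈-refl g≈g′

  _⟩∘⟨refl : ∀ {a b c} {f f′ : Hom b c} {g : Hom a b} → f ≈ f′ → f ∘ g ≈ f′ ∘ g
  f≈f′ ⟩∘⟨refl = ∘-resp f≈f′ ≈-refl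

  sym-assoc : ∀ {a b c d} (f : Hom c d) (g : Hom b c) (k : Hom a b) → f ∘ (g ∘ k) ≈ (f ∘ g) ∘ k
  sym-assoc f g k = ≈-sym (∘-assoc f g k)

  pullˡ : ∀ {a b c d} {f : Hom c d} {g : Hom b c} {fg : Hom b d} {k : Hom a b}
          → f ∘ g ≈ fg → f ∘ (g ∘ k) ≈ fg ∘ k
  pullˡ {f = f} {g} {k = k} f∘g≈fg = ≈-trans (sym-assoc f g k) (f∘g≈fg ⟩∘⟨refl)

  pullʳ : ∀ {a b c d} {f : Hom c d} {g : Hom b c} {k : Hom a b} {gk : Hom a c}
          → g ∘ k ≈ gk → (f ∘ g) ∘ k ≈ f ∘ gk
  pullʳ {f = f} {g} {k} g∘k≈gk = ≈-trans (∘-assoc f g k) (refl⟩∘⟨ g∘k≈gk)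

  !-ext : ∀ {a} (f g : Hom a 𝟙) → f ≈ g
  !-ext f g = ≈-trans (!-unique f) (≈-sym (!-unique g))

  ⊠-ext : ∀ {c a b} {k k′ : Hom c (a ⊠ b)} → π₁ ∘ k ≈ π₁ ∘ k′ → π₂ ∘ k ≈ π₂ ∘ k′ → k ≈ k′
  ⊠-ext {k = k} {k′} p₁ p₂ =
    ≈-trans (⟨⟩-unique _ _ k p₁ p₂) (≈-sym (⟨⟩-unique _ _ k′ ≈-refl ≈-refl))

  ⟨⟩-cong₂ : ∀ {c a b} {f f′ : Hom c a} {g g′ : Hom c b} → f ≈ f′ → g ≈ g′ → ⟨ f , g ⟩ ≈ ⟨ f′ , g′ ⟩
  ⟨⟩-cong₂ {f = f} {g = g} f≈f′ g≈g′ =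
    ⟨⟩-unique _ _ ⟨ f , g ⟩ (≈-trans (π₁-β f g) f≈f′) (≈-trans (π₂-β f g) g≈g′)

  ⟨⟩∘ : ∀ {d c a b} (f : Hom c a) (g : Hom c b) (k : Hom d c) → ⟨ f , g ⟩ ∘ k ≈ ⟨ f ∘ k , g ∘ k ⟩
  ⟨⟩∘ f g k = ⟨⟩-unique _ _ _
    (≈-trans (sym-assoc π₁ ⟨ f , g ⟩ k) (π₁-β f g ⟩∘⟨refl))
    (≈-trans (sym-assoc π₂ ⟨ f , g ⟩ k) (π₂-β f g ⟩∘⟨refl))

  id⊠id : ∀ {a b} → id {a} ⊠m id {b} ≈ id
  id⊠id = ≈-sym (⟨⟩-unique _ _ id (≈-trans (idʳ π₁) (≈-sym (idˡ π₁))) (≈-trans (idʳ π₂) (≈-sym (idˡ π₂))))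

  split-mono-cancel : ∀ {a b c} {u : Hom b a} {w : Hom a b} {k k′ : Hom c a}
                      → u ∘ w ≈ id → w ∘ k ≈ w ∘ k′ → k ≈ k′
  split-mono-cancel {u = u} {w} {k} {k′} u∘w≈id w∘k≈w∘k′ = begin⟨ homSetoid ⟩
    k             ≈⟨ idˡ k ⟨
    id ∘ k        ≈⟨ u∘w≈id ⟩∘⟨refl ⟨
    (u ∘ w) ∘ k   ≈⟨ ∘-assoc u w k ⟩
    u ∘ (w ∘ k)   ≈⟨ refl⟩∘⟨ w∘k≈w∘k′ ⟩
    u ∘ (w ∘ k′)  ≈⟨ sym-assoc u w k′ ⟩
    (u ∘ w) ∘ k′  ≈⟨ u∘w≈id ⟩∘⟨refl ⟩
    id ∘ k′       ≈⟨ idˡ k′ ⟩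
    k′            ∎

  Pmap-cong : ∀ {b c} (f : Hom b c) {x y : P c} → x ≃ y → Pmap f x ≃ Pmap f y
  Pmap-cong f (x≤y , y≤x) = Pmap-mono f x≤y , Pmap-mono f y≤x

  ⊗-cong : ∀ {c} {x x′ y y′ : P c} → x ≃ x′ → y ≃ y′ → x ⊗P y ≃ x′ ⊗P y′
  ⊗-cong x≃x′ y≃y′ = op-resp tensor (x≃x′ ∷ y≃y′ ∷ [])

  Pmap-⊗ : ∀ {b c} (f : Hom b c) (x y : P c) → Pmap f (x ⊗P y) ≃ Pmap f x ⊗P Pmap f y
  Pmap-⊗ f x y = op-nat tensor f (x ∷ y ∷ [])

  Pmap-e : ∀ {b c} (f : Hom b c) → Pmap f (eP {c}) ≃ eP
  Pmap-e f = op-nat eConn f []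

  ⊠m-cong : ∀ {a b c d} {f f′ : Hom a b} {g g′ : Hom c d} → f ≈ f′ → g ≈ g′ → f ⊠m g ≈ f′ ⊠m g′
  ⊠m-cong f≈f′ g≈g′ = ⟨⟩-cong₂ (f≈f′ ⟩∘⟨refl) (g≈g′ ⟩∘⟨refl)

  Pmap-Eq-⊠ : ∀ {d c₁ c₂} (k : Hom d ((c₁ ⊠ c₂) ⊠ (c₁ ⊠ c₂)))
              → Pmap (⟨ π₁ ∘ π₁ , π₁ ∘ π₂ ⟩ ∘ k) (Eq c₁) ⊗P Pmap (⟨ π₂ ∘ π₁ , π₂ ∘ π₂ ⟩ ∘ k) (Eq c₂)
                ≃ Pmap k (Eq (c₁ ⊠ c₂))
  Pmap-Eq-⊠ {c₁ = c₁} {c₂} k = begin⟨ predSetoid ⟩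
    Pmap (⟨ π₁ ∘ π₁ , π₁ ∘ π₂ ⟩ ∘ k) (Eq c₁) ⊗P Pmap (⟨ π₂ ∘ π₁ , π₂ ∘ π₂ ⟩ ∘ k) (Eq c₂)
      ≈⟨ ⊗-cong (Pmap-∘ _ k _) (Pmap-∘ _ k _) ⟩
    Pmap k (Pmap ⟨ π₁ ∘ π₁ , π₁ ∘ π₂ ⟩ (Eq c₁)) ⊗P Pmap k (Pmap ⟨ π₂ ∘ π₁ , π₂ ∘ π₂ ⟩ (Eq c₂))
      ≈⟨ Pmap-⊗ k _ _ ⟨
    Pmap k (Pmap ⟨ π₁ ∘ π₁ , π₁ ∘ π₂ ⟩ (Eq c₁) ⊗P Pmap ⟨ π₂ ∘ π₁ , π₂ ∘ π₂ ⟩ (Eq c₂))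
      ≈⟨ Pmap-cong k (Eq-⊠ c₁ c₂) ⟨
    Pmap k (Eq (c₁ ⊠ c₂)) ∎

  idToHom : ∀ {a b} → a ≡ b → Hom a b
  idToHom refl = id

  idToHom-symˡ : ∀ {a b} (a≡b : a ≡ b) → idToHom (sym a≡b) ∘ idToHom a≡b ≈ id
  idToHom-symˡ refl = idˡ id

  idToHom-symʳ : ∀ {a b} (a≡b : a ≡ b) → idToHom a≡b ∘ idToHom (sym a≡b) ≈ id
  idToHom-symʳ refl = idˡ id

  idToHom-⊠ : ∀ {a a′ b b′} (a≡a′ : a ≡ a′) (b≡b′ : b ≡ b′)
              → idToHom (cong₂ _⊠_ a≡a′ b≡b′) ≈ idToHom a≡a′ ⊠m idToHom b≡b′
  idToHom-⊠ refl refl = ≈-sym id⊠id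

  subst₂-Hom : ∀ {a a′ b b′} (a≡a′ : a ≡ a′) (b≡b′ : b ≡ b′) (f : Hom a b)
               → subst₂ Hom a≡a′ b≡b′ f ≈ idToHom b≡b′ ∘ (f ∘ idToHom (sym a≡a′))
  subst₂-Hom refl refl f = ≈-sym (≈-trans (idˡ _) (idʳ f))

  subst-P : ∀ {a a′} (a≡a′ : a ≡ a′) (x : P a) → subst P a≡a′ x ≃ Pmap (idToHom (sym a≡a′)) x
  subst-P refl x = ≃-sym (Pmap-id x)

  Eq-idToHom : ∀ {c c′} (c≡c′ : c ≡ c′) → Eq c ≃ Pmap (idToHom c≡c′ ⊠m idToHom c≡c′) (Eq c′)
  Eq-idToHom refl = ≃-sym (≃-trans (Pmap-resp id⊠id _) (Pmap-id _))

  Ω-idToHom : ∀ q b {c c′} (c≡c′ : c ≡ c′) (x : P (b ⊠ c))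
              → Ω q b c x ≃ Ω q b c′ (Pmap (id ⊠m idToHom (sym c≡c′)) x)
  Ω-idToHom q b refl x = Ω-resp q b _ (≃-sym (≃-trans (Pmap-resp id⊠id x) (Pmap-id x)))

module SyntaxProperties (ℒ : Language) (Sg : Signature) where
  open Syntax ℒ Sg
  open Signature Sg

  lookup-tab : ∀ {Γ Δ σ} (f : ∀ {τ} → Δ ∋ τ → Tm Γ τ) (x : Δ ∋ σ) → lookup (tab f) x ≡ f x
  lookup-tab f here = refl
  lookup-tab f (there x) = lookup-tab (λ y → f (there y)) x

  lookup-subTs : ∀ {Γ Δ Θ σ} (ρ : Tms Γ Δ) (ts : Tms Δ Θ) (x : Θ ∋ σ)
                 → lookup (subTs ρ ts) x ≡ subT ρ (lookup ts x)
  lookup-subTs ρ (ts , t) here = refl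
  lookup-subTs ρ (ts , t) (there x) = lookup-subTs ρ ts x

  lookup-renTs : ∀ {Γ Δ Θ σ} (ren : ∀ {τ} → Δ ∋ τ → Γ ∋ τ) (ts : Tms Δ Θ) (x : Θ ∋ σ)
                 → lookup (renTs ren ts) x ≡ renT ren (lookup ts x)
  lookup-renTs ren (ts , t) here = refl
  lookup-renTs ren (ts , t) (there x) = lookup-renTs ren ts x

  Tms-ext : ∀ {Γ Δ} (ρ ρ′ : Tms Γ Δ) → (∀ {σ} (x : Δ ∋ σ) → lookup ρ x ≡ lookup ρ′ x) → ρ ≡ ρ′
  Tms-ext ε ε _ = refl
  Tms-ext (ρ , s) (ρ′ , t) same = cong₂ _,_ (Tms-ext ρ ρ′ (λ x → same (there x))) (same here)

  mutual
    renT≡subT : ∀ {Γ Δ σ} (ren : ∀ {τ} → Δ ∋ τ → Γ ∋ τ) (t : Tm Δ σ)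
                → renT ren t ≡ subT (tab (λ x → var (ren x))) t
    renT≡subT ren (var x) = sym (lookup-tab (λ y → var (ren y)) x)
    renT≡subT ren (app f ts) = cong (app f) (renTs≡subTs ren ts)

    renTs≡subTs : ∀ {Γ Δ Θ} (ren : ∀ {τ} → Δ ∋ τ → Γ ∋ τ) (ts : Tms Δ Θ)
                  → renTs ren ts ≡ subTs (tab (λ x → var (ren x))) ts
    renTs≡subTs ren ε = refl
    renTs≡subTs ren (ts , t) = cong₂ _,_ (renTs≡subTs ren ts) (renT≡subT ren t)

  weakening : ∀ {Γ σ} → Tms (Γ ▷ σ) Γ
  weakening = tab (λ x → var (there x))

  split : ∀ {Γ σ} (Δ : Cx) → (Γ ++ Δ) ∋ σ → (Γ ∋ σ) ⊎ (Δ ∋ σ)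
  split ε x = inj₁ x
  split (Δ ▷ τ) here = inj₂ here
  split (Δ ▷ τ) (there x) = Sum.map₂ there (split Δ x)

  join : ∀ {Γ σ} (Δ : Cx) → (Γ ∋ σ) ⊎ (Δ ∋ σ) → (Γ ++ Δ) ∋ σ
  join Δ (inj₁ x) = wkL {Δ = Δ} x
  join Δ (inj₂ x) = wkR x

  split-wkL : ∀ {Γ σ} (Δ : Cx) (x : Γ ∋ σ) → split Δ (wkL {Δ = Δ} x) ≡ inj₁ x
  split-wkL ε x = refl
  split-wkL (Δ ▷ τ) x rewrite split-wkL Δ x = refl

  split-wkR : ∀ {Γ σ} (Δ : Cx) (x : Δ ∋ σ) → split {Γ} Δ (wkR x) ≡ inj₂ x
  split-wkR (Δ ▷ τ) here = refl
  split-wkR {Γ} (Δ ▷ τ) (there x) rewrite split-wkR {Γ} Δ x = refl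

  join-split : ∀ {Γ σ} (Δ : Cx) (x : (Γ ++ Δ) ∋ σ) → join Δ (split Δ x) ≡ x
  join-split ε x = refl
  join-split (Δ ▷ τ) here = refl
  join-split {Γ} (Δ ▷ τ) (there x) with split Δ x | join-split {Γ} Δ x
  ... | inj₁ y | joined = cong there joined
  ... | inj₂ y | joined = cong there joined

  eqAtom : ∀ Γ → Σ Sort (Γ ∋_) → Fm (Γ ++ Γ)
  eqAtom Γ (σ , x) = eq σ (var (wkL {Δ = Γ} x)) (var (wkR x))

  eqFm≡bigF-eqAtom : ∀ Γ → eqFm Γ ≡ bigF (List.map (eqAtom Γ) (allVars Γ))
  eqFm≡bigF-eqAtom Γ = cong bigF (List.map-cong (λ { (σ , x) → refl }) (allVars Γ))

  weakenBoth : ∀ {Γ σ} → Tms ((Γ ▷ σ) ++ (Γ ▷ σ)) (Γ ++ Γ)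
  weakenBoth {Γ} {σ} = tab λ v →
    var (Sum.[ (λ x → wkL {Δ = Γ ▷ σ} (there x)) , (λ x → wkR (there x)) ] (split Γ v))

  lookup-weakenBoth-wkL : ∀ Γ σ {τ} (x : Γ ∋ τ)
                          → lookup (weakenBoth {Γ} {σ}) (wkL {Δ = Γ} x) ≡ var (wkL {Δ = Γ ▷ σ} (there x))
  lookup-weakenBoth-wkL Γ σ x =
    trans (lookup-tab _ (wkL {Δ = Γ} x)) (cong (λ s → var (Sum.[ _ , _ ] s)) (split-wkL Γ x))

  lookup-weakenBoth-wkR : ∀ Γ σ {τ} (x : Γ ∋ τ)
                          → lookup (weakenBoth {Γ} {σ}) (wkR {Γ = Γ} x) ≡ var (wkR {Γ = Γ ▷ σ} (there x))
  lookup-weakenBoth-wkR Γ σ x =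
    trans (lookup-tab _ (wkR {Γ = Γ} x)) (cong (λ s → var (Sum.[ _ , _ ] s)) (split-wkR {Γ} Γ x))

  eqAtom-there : ∀ Γ σ (v : Σ Sort (Γ ∋_))
                 → eqAtom (Γ ▷ σ) (proj₁ v , there (proj₂ v)) ≡ subF (weakenBoth {Γ} {σ}) (eqAtom Γ v)
  eqAtom-there Γ σ (τ , x) = sym (cong₂ (eq τ) (lookup-weakenBoth-wkL Γ σ x) (lookup-weakenBoth-wkR Γ σ x))

  eqFm-▷ : ∀ Γ σ → eqFm (Γ ▷ σ)
           ≡ bigF (List.map (subF weakenBoth) (List.map (eqAtom Γ) (allVars Γ))
                   List.∷ʳ eqAtom (Γ ▷ σ) (σ , here))
  eqFm-▷ Γ σ = begin
    eqFm (Γ ▷ σ)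
      ≡⟨ eqFm≡bigF-eqAtom (Γ ▷ σ) ⟩
    bigF (List.map (eqAtom (Γ ▷ σ)) (List.map thereᵥ (allVars Γ) List.∷ʳ (σ , here)))
      ≡⟨ cong bigF (List.map-++ (eqAtom (Γ ▷ σ)) (List.map thereᵥ (allVars Γ)) _) ⟩
    bigF (List.map (eqAtom (Γ ▷ σ)) (List.map thereᵥ (allVars Γ)) List.∷ʳ eqAtom (Γ ▷ σ) (σ , here))
      ≡⟨ cong (λ φs → bigF (φs List.∷ʳ _)) eqAtoms-there ⟩
    bigF (List.map (subF weakenBoth) (List.map (eqAtom Γ) (allVars Γ)) List.∷ʳ eqAtom (Γ ▷ σ) (σ , here)) ∎
    where
    open ≡-Reasoning
    thereᵥ : Σ Sort (Γ ∋_) → Σ Sort ((Γ ▷ σ) ∋_)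
    thereᵥ (τ , x) = τ , there x
    eqAtoms-there : List.map (eqAtom (Γ ▷ σ)) (List.map thereᵥ (allVars Γ))
                    ≡ List.map (subF weakenBoth) (List.map (eqAtom Γ) (allVars Γ))
    eqAtoms-there = trans (sym (List.map-∘ (allVars Γ)))
      (trans (List.map-cong (eqAtom-there Γ σ) (allVars Γ)) (List.map-∘ (allVars Γ)))

  subF-foldl : ∀ {Γ Δ} (ρ : Tms Γ Δ) (φ : Fm Δ) (φs : List (Fm Δ))
               → subF ρ (foldl _⊗F_ φ φs) ≡ foldl _⊗F_ (subF ρ φ) (List.map (subF ρ) φs)
  subF-foldl ρ φ [] = refl
  subF-foldl ρ φ (ψ ∷ φs) = subF-foldl ρ (φ ⊗F ψ) φs

  subF-bigF : ∀ {Γ Δ} (ρ : Tms Γ Δ) (φs : List (Fm Δ)) → subF ρ (bigF φs) ≡ bigF (List.map (subF ρ) φs)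
  subF-bigF ρ [] = refl
  subF-bigF ρ (φ ∷ φs) = subF-foldl ρ φ φs

module Semantics {ℒ : Language} {Sg : Signature} {o h e p r : Level} (X : FA ℒ o h e p r)
                 (S : Interp.Structure ℒ Sg (FA.raw X)) where
  open FAProperties X
  open Interp ℒ Sg (FA.raw X) using (⟦_⟧c; varI; canon; tmI; tmsI; fmI; fmIs; module Structure)
  open Structure S
  open Syntax ℒ Sg
  open SyntaxProperties ℒ Sg
  open MultiSetoidReasoning

  ⟦_⟧ᶜ : Cx → Obj
  ⟦ Γ ⟧ᶜ = ⟦ S ⟧c Γ

  ⟦_⟧ᵛ : ∀ {Γ σ} → Γ ∋ σ → Hom ⟦ Γ ⟧ᶜ (sortI σ)
  ⟦ x ⟧ᵛ = varI S x

  ⟦_⟧ᵗ : ∀ {Γ σ} → Tm Γ σ → Hom ⟦ Γ ⟧ᶜ (sortI σ)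
  ⟦ t ⟧ᵗ = tmI S t

  ⟦_⟧ˢ : ∀ {Γ Δ} → Tms Γ Δ → Hom ⟦ Γ ⟧ᶜ ⟦ Δ ⟧ᶜ
  ⟦ ts ⟧ˢ = tmsI S ts

  ⟦_⟧ᶠ : ∀ {Γ} → Fm Γ → P ⟦ Γ ⟧ᶜ
  ⟦ φ ⟧ᶠ = fmI S φ

  tuple : ∀ Δ {c} → (∀ {σ} → Δ ∋ σ → Hom c (sortI σ)) → Hom c ⟦ Δ ⟧ᶜ
  tuple ε u = !
  tuple (ε ▷ σ) u = u here
  tuple (Δ ▷ τ ▷ σ) u = ⟨ tuple (Δ ▷ τ) (λ x → u (there x)) , u here ⟩

  tuple-β : ∀ Δ {c} (u : ∀ {σ} → Δ ∋ σ → Hom c (sortI σ)) {σ} (x : Δ ∋ σ) → ⟦ x ⟧ᵛ ∘ tuple Δ u ≈ u x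
  tuple-β (ε ▷ σ) u here = idˡ _
  tuple-β (Δ ▷ τ ▷ σ) u here = π₂-β _ _
  tuple-β (Δ ▷ τ ▷ σ) u (there x) = ≈-trans (pullʳ (π₁-β _ _)) (tuple-β (Δ ▷ τ) (λ y → u (there y)) x)

  vars-jointly-monic : ∀ Δ {c} (k k′ : Hom c ⟦ Δ ⟧ᶜ) → (∀ {σ} (x : Δ ∋ σ) → ⟦ x ⟧ᵛ ∘ k ≈ ⟦ x ⟧ᵛ ∘ k′) → k ≈ k′
  vars-jointly-monic ε k k′ _ = !-ext k k′
  vars-jointly-monic (ε ▷ σ) k k′ same = ≈-trans (≈-sym (idˡ k)) (≈-trans (same here) (idˡ k′))
  vars-jointly-monic (Δ ▷ τ ▷ σ) k k′ same = ⊠-ext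
    (vars-jointly-monic (Δ ▷ τ) (π₁ ∘ k) (π₁ ∘ k′)
      (λ x → ≈-trans (sym-assoc _ π₁ k) (≈-trans (same (there x)) (∘-assoc _ π₁ k′))))
    (same here)

  var∘tms : ∀ {Γ Δ σ} (ts : Tms Γ Δ) (x : Δ ∋ σ) → ⟦ x ⟧ᵛ ∘ ⟦ ts ⟧ˢ ≈ ⟦ lookup ts x ⟧ᵗ
  var∘tms (ε , t) here = idˡ _
  var∘tms ((ts , s) , t) here = π₂-β _ _
  var∘tms ((ts , s) , t) (there x) = ≈-trans (pullʳ (π₁-β _ _)) (var∘tms (ts , s) x)

  var∘tms≡ : ∀ {Γ Δ σ} (ts : Tms Γ Δ) (x : Δ ∋ σ) {t : Tm Γ σ} → lookup ts x ≡ t → ⟦ x ⟧ᵛ ∘ ⟦ ts ⟧ˢ ≈ ⟦ t ⟧ᵗ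
  var∘tms≡ ts x refl = var∘tms ts x

  mutual
    tmI-subT : ∀ {Γ Δ σ} (ρ : Tms Γ Δ) (t : Tm Δ σ) → ⟦ subT ρ t ⟧ᵗ ≈ ⟦ t ⟧ᵗ ∘ ⟦ ρ ⟧ˢ
    tmI-subT ρ (var x) = ≈-sym (var∘tms ρ x)
    tmI-subT ρ (app f ts) = ≈-trans (refl⟩∘⟨ tmsI-subTs ρ ts) (sym-assoc _ _ _)

    tmI-lookup-subTs : ∀ {Γ Δ Θ σ} (ρ : Tms Γ Δ) (ts : Tms Δ Θ) (x : Θ ∋ σ)
                       → ⟦ lookup (subTs ρ ts) x ⟧ᵗ ≈ ⟦ lookup ts x ⟧ᵗ ∘ ⟦ ρ ⟧ˢ
    tmI-lookup-subTs ρ (ts , t) here = tmI-subT ρ t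
    tmI-lookup-subTs ρ (ts , t) (there x) = tmI-lookup-subTs ρ ts x

    tmsI-subTs : ∀ {Γ Δ Θ} (ρ : Tms Γ Δ) (ts : Tms Δ Θ) → ⟦ subTs ρ ts ⟧ˢ ≈ ⟦ ts ⟧ˢ ∘ ⟦ ρ ⟧ˢ
    tmsI-subTs {Θ = Θ} ρ ts = vars-jointly-monic Θ _ _ λ x → begin⟨ homSetoid ⟩
      ⟦ x ⟧ᵛ ∘ ⟦ subTs ρ ts ⟧ˢ      ≈⟨ var∘tms (subTs ρ ts) x ⟩
      ⟦ lookup (subTs ρ ts) x ⟧ᵗ    ≈⟨ tmI-lookup-subTs ρ ts x ⟩
      ⟦ lookup ts x ⟧ᵗ ∘ ⟦ ρ ⟧ˢ      ≈⟨ pullˡ (var∘tms ts x) ⟨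
      ⟦ x ⟧ᵛ ∘ (⟦ ts ⟧ˢ ∘ ⟦ ρ ⟧ˢ)    ∎

  tmsI-idS : ∀ {Γ} → ⟦ idS {Γ} ⟧ˢ ≈ id
  tmsI-idS {Γ} = vars-jointly-monic Γ _ _ λ x →
    ≈-trans (var∘tms≡ idS x (lookup-tab var x)) (≈-sym (idʳ _))

  canon-here : ∀ Γ σ → ⟦ here {Γ = Γ} {σ = σ} ⟧ᵛ ∘ canon S Γ σ ≈ π₂
  canon-here ε σ = idˡ _
  canon-here (Γ ▷ τ) σ = idʳ _

  canon-there : ∀ Γ σ {τ} (y : Γ ∋ τ) → ⟦ there {τ = σ} y ⟧ᵛ ∘ canon S Γ σ ≈ ⟦ y ⟧ᵛ ∘ π₁
  canon-there (Γ ▷ υ) σ y = idʳ _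

  weaken : ∀ Γ σ → Hom ⟦ Γ ▷ σ ⟧ᶜ ⟦ Γ ⟧ᶜ
  weaken Γ σ = ⟦ weakening {Γ} {σ} ⟧ˢ

  var∘weaken : ∀ {Γ σ τ} (y : Γ ∋ τ) → ⟦ y ⟧ᵛ ∘ weaken Γ σ ≈ ⟦ there {τ = σ} y ⟧ᵛ
  var∘weaken {Γ} {σ} y = var∘tms≡ (weakening {Γ} {σ}) y (lookup-tab (λ x → var (there x)) y)

  tmI-renT-there : ∀ {Γ σ τ} (t : Tm Γ τ) → ⟦ renT (there {τ = σ}) t ⟧ᵗ ≈ ⟦ t ⟧ᵗ ∘ weaken Γ σ
  tmI-renT-there t = ≈-trans (≡⇒≈ (cong ⟦_⟧ᵗ (renT≡subT there t))) (tmI-subT weakening t)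

  weaken∘canon : ∀ Γ σ → weaken Γ σ ∘ canon S Γ σ ≈ π₁
  weaken∘canon Γ σ = vars-jointly-monic Γ _ _ λ y →
    ≈-trans (pullˡ (var∘weaken y)) (canon-there Γ σ y)

  lift∘canon : ∀ {Γ Δ σ} (ρ : Tms Γ Δ) → ⟦ lift {σ = σ} ρ ⟧ˢ ∘ canon S Γ σ ≈ canon S Δ σ ∘ (⟦ ρ ⟧ˢ ⊠m id)
  lift∘canon {Γ} {Δ} {σ} ρ = vars-jointly-monic (Δ ▷ σ) _ _ componentwise
    where
    componentwise : ∀ {τ} (x : (Δ ▷ σ) ∋ τ)
                    → ⟦ x ⟧ᵛ ∘ (⟦ lift ρ ⟧ˢ ∘ canon S Γ σ) ≈ ⟦ x ⟧ᵛ ∘ (canon S Δ σ ∘ (⟦ ρ ⟧ˢ ⊠m id))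
    componentwise here = begin⟨ homSetoid ⟩
      ⟦ here {Γ = Δ} ⟧ᵛ ∘ (⟦ lift ρ ⟧ˢ ∘ canon S Γ σ) ≈⟨ pullˡ (var∘tms (lift ρ) here) ⟩
      ⟦ here {Γ = Γ} ⟧ᵛ ∘ canon S Γ σ          ≈⟨ canon-here Γ σ ⟩
      π₂                                        ≈⟨ idˡ π₂ ⟨
      id ∘ π₂                                   ≈⟨ π₂-β _ _ ⟨
      π₂ ∘ (⟦ ρ ⟧ˢ ⊠m id)                        ≈⟨ pullˡ (canon-here Δ σ) ⟨
      ⟦ here {Γ = Δ} ⟧ᵛ ∘ (canon S Δ σ ∘ (⟦ ρ ⟧ˢ ⊠m id)) ∎
    componentwise (there y) = begin⟨ homSetoid ⟩
      ⟦ there {τ = σ} y ⟧ᵛ ∘ (⟦ lift ρ ⟧ˢ ∘ canon S Γ σ)    ≈⟨ pullˡ (var∘tms (lift ρ) (there y)) ⟩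
      ⟦ lookup (wkS ρ) y ⟧ᵗ ∘ canon S Γ σ           ≈⟨ ≡⇒≈ (cong ⟦_⟧ᵗ (lookup-renTs there ρ y)) ⟩∘⟨refl ⟩
      ⟦ renT there (lookup ρ y) ⟧ᵗ ∘ canon S Γ σ    ≈⟨ tmI-renT-there (lookup ρ y) ⟩∘⟨refl ⟩
      (⟦ lookup ρ y ⟧ᵗ ∘ weaken Γ σ) ∘ canon S Γ σ  ≈⟨ pullʳ (weaken∘canon Γ σ) ⟩
      ⟦ lookup ρ y ⟧ᵗ ∘ π₁                          ≈⟨ pullˡ (var∘tms ρ y) ⟨
      ⟦ y ⟧ᵛ ∘ (⟦ ρ ⟧ˢ ∘ π₁)                        ≈⟨ pullʳ (π₁-β _ _) ⟨
      (⟦ y ⟧ᵛ ∘ π₁) ∘ (⟦ ρ ⟧ˢ ⊠m id)                ≈⟨ pullˡ (canon-there Δ σ y) ⟨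
      ⟦ there {τ = σ} y ⟧ᵛ ∘ (canon S Δ σ ∘ (⟦ ρ ⟧ˢ ⊠m id)) ∎

  mutual
    fmI-subF : ∀ {Γ Δ} (ρ : Tms Γ Δ) (φ : Fm Δ) → ⟦ subF ρ φ ⟧ᶠ ≃ Pmap ⟦ ρ ⟧ˢ ⟦ φ ⟧ᶠ
    fmI-subF ρ (rel R ts) = ≃-trans (Pmap-resp (tmsI-subTs ρ ts) _) (Pmap-∘ _ _ _)
    fmI-subF ρ (eq σ M N) =
      ≃-trans (Pmap-resp (≈-trans (⟨⟩-cong₂ (tmI-subT ρ M) (tmI-subT ρ N)) (≈-sym (⟨⟩∘ _ _ _))) _)
              (Pmap-∘ _ _ _)
    fmI-subF ρ (conn k φs) = ≃-trans (op-resp k (fmIs-subFs ρ φs)) (≃-sym (op-nat k ⟦ ρ ⟧ˢ (fmIs S φs)))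
    fmI-subF {Γ} {Δ} ρ (quant q σ φ) = begin⟨ predSetoid ⟩
      Ω q ⟦ Γ ⟧ᶜ (sortI σ) (Pmap (canon S Γ σ) ⟦ subF (lift ρ) φ ⟧ᶠ)
        ≈⟨ Ω-resp q _ _ (Pmap-cong (canon S Γ σ) (fmI-subF (lift ρ) φ)) ⟩
      Ω q ⟦ Γ ⟧ᶜ (sortI σ) (Pmap (canon S Γ σ) (Pmap ⟦ lift ρ ⟧ˢ ⟦ φ ⟧ᶠ))
        ≈⟨ Ω-resp q _ _ (Pmap-∘ _ _ _) ⟨
      Ω q ⟦ Γ ⟧ᶜ (sortI σ) (Pmap (⟦ lift ρ ⟧ˢ ∘ canon S Γ σ) ⟦ φ ⟧ᶠ)
        ≈⟨ Ω-resp q _ _ (≃-trans (Pmap-resp (lift∘canon ρ) _) (Pmap-∘ _ _ _)) ⟩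
      Ω q ⟦ Γ ⟧ᶜ (sortI σ) (Pmap (⟦ ρ ⟧ˢ ⊠m id) (Pmap (canon S Δ σ) ⟦ φ ⟧ᶠ))
        ≈⟨ Ω-nat q (sortI σ) ⟦ ρ ⟧ˢ _ ⟨
      Pmap ⟦ ρ ⟧ˢ (Ω q ⟦ Δ ⟧ᶜ (sortI σ) (Pmap (canon S Δ σ) ⟦ φ ⟧ᶠ)) ∎

    fmIs-subFs : ∀ {Γ Δ n} (ρ : Tms Γ Δ) (φs : Vec (Fm Δ) n)
                 → Pointwise _≃_ (fmIs S (subFs ρ φs)) (Vec.map (Pmap ⟦ ρ ⟧ˢ) (fmIs S φs))
    fmIs-subFs ρ [] = []
    fmIs-subFs ρ (φ ∷ φs) = fmI-subF ρ φ ∷ fmIs-subFs ρ φs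

  fmIs≡map : ∀ {Γ n} (φs : Vec (Fm Γ) n) → fmIs S φs ≡ Vec.map ⟦_⟧ᶠ φs
  fmIs≡map [] = refl
  fmIs≡map (φ ∷ φs) = cong (⟦ φ ⟧ᶠ ∷_) (fmIs≡map φs)

  fmI-bigF-∷ʳ : ∀ {Γ} (φs : List (Fm Γ)) (ψ : Fm Γ) → ⟦ bigF (φs List.∷ʳ ψ) ⟧ᶠ ≃ ⟦ bigF φs ⟧ᶠ ⊗P ⟦ ψ ⟧ᶠ
  fmI-bigF-∷ʳ [] ψ = ≃-sym (⊗-idˡ _)
  fmI-bigF-∷ʳ (φ ∷ φs) ψ = ≡⇒≃ (cong ⟦_⟧ᶠ (List.foldl-++ _⊗F_ φ φs (ψ ∷ [])))

  project : ∀ {Γ Δ σ} → (Γ ∋ σ) ⊎ (Δ ∋ σ) → Hom (⟦ Γ ⟧ᶜ ⊠ ⟦ Δ ⟧ᶜ) (sortI σ)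
  project (inj₁ x) = ⟦ x ⟧ᵛ ∘ π₁
  project (inj₂ x) = ⟦ x ⟧ᵛ ∘ π₂

  ⊠⇒++ : ∀ Γ Δ → Hom (⟦ Γ ⟧ᶜ ⊠ ⟦ Δ ⟧ᶜ) ⟦ Γ ++ Δ ⟧ᶜ
  ⊠⇒++ Γ Δ = tuple (Γ ++ Δ) (λ x → project {Γ} {Δ} (split Δ x))

  var∘⊠⇒++ : ∀ Γ Δ {σ} (x : (Γ ++ Δ) ∋ σ) → ⟦ x ⟧ᵛ ∘ ⊠⇒++ Γ Δ ≈ project (split Δ x)
  var∘⊠⇒++ Γ Δ = tuple-β (Γ ++ Δ) _

  ++⇒⊠ : ∀ Γ Δ → Hom ⟦ Γ ++ Δ ⟧ᶜ (⟦ Γ ⟧ᶜ ⊠ ⟦ Δ ⟧ᶜ)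
  ++⇒⊠ Γ Δ = ⟨ ⟦ π₁S {Γ} {Δ} ⟧ˢ , ⟦ π₂S {Γ} {Δ} ⟧ˢ ⟩

  var∘π₁S : ∀ Γ Δ {σ} (x : Γ ∋ σ) → ⟦ x ⟧ᵛ ∘ ⟦ π₁S {Γ} {Δ} ⟧ˢ ≈ ⟦ wkL {Δ = Δ} x ⟧ᵛ
  var∘π₁S Γ Δ x = var∘tms≡ (π₁S {Γ} {Δ}) x (lookup-tab (λ y → var (wkL {Δ = Δ} y)) x)

  var∘π₂S : ∀ Γ Δ {σ} (x : Δ ∋ σ) → ⟦ x ⟧ᵛ ∘ ⟦ π₂S {Γ} {Δ} ⟧ˢ ≈ ⟦ wkR {Γ = Γ} x ⟧ᵛ
  var∘π₂S Γ Δ x = var∘tms≡ (π₂S {Γ} {Δ}) x (lookup-tab (λ y → var (wkR {Γ = Γ} y)) x)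

  project∘++⇒⊠ : ∀ Γ Δ {σ} (s : (Γ ∋ σ) ⊎ (Δ ∋ σ)) → project s ∘ ++⇒⊠ Γ Δ ≈ ⟦ join Δ s ⟧ᵛ
  project∘++⇒⊠ Γ Δ (inj₁ x) = ≈-trans (pullʳ (π₁-β _ _)) (var∘π₁S Γ Δ x)
  project∘++⇒⊠ Γ Δ (inj₂ x) = ≈-trans (pullʳ (π₂-β _ _)) (var∘π₂S Γ Δ x)

  ⊠⇒++∘++⇒⊠ : ∀ Γ Δ → ⊠⇒++ Γ Δ ∘ ++⇒⊠ Γ Δ ≈ id
  ⊠⇒++∘++⇒⊠ Γ Δ = vars-jointly-monic (Γ ++ Δ) _ _ λ x → begin⟨ homSetoid ⟩
    ⟦ x ⟧ᵛ ∘ (⊠⇒++ Γ Δ ∘ ++⇒⊠ Γ Δ) ≈⟨ pullˡ (var∘⊠⇒++ Γ Δ x) ⟩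
    project (split Δ x) ∘ ++⇒⊠ Γ Δ ≈⟨ project∘++⇒⊠ Γ Δ (split Δ x) ⟩
    ⟦ join Δ (split Δ x) ⟧ᵛ        ≈⟨ ≡⇒≈ (cong ⟦_⟧ᵛ (join-split Δ x)) ⟩
    ⟦ x ⟧ᵛ                         ≈⟨ idʳ _ ⟨
    ⟦ x ⟧ᵛ ∘ id                    ∎

  π₁S∘⊠⇒++ : ∀ Γ Δ → ⟦ π₁S {Γ} {Δ} ⟧ˢ ∘ ⊠⇒++ Γ Δ ≈ π₁
  π₁S∘⊠⇒++ Γ Δ = vars-jointly-monic Γ _ _ λ x →
    ≈-trans (pullˡ (var∘π₁S Γ Δ x)) (≈-trans (var∘⊠⇒++ Γ Δ _) (≡⇒≈ (cong project (split-wkL Δ x))))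

  π₂S∘⊠⇒++ : ∀ Γ Δ → ⟦ π₂S {Γ} {Δ} ⟧ˢ ∘ ⊠⇒++ Γ Δ ≈ π₂
  π₂S∘⊠⇒++ Γ Δ = vars-jointly-monic Δ _ _ λ x →
    ≈-trans (pullˡ (var∘π₂S Γ Δ x)) (≈-trans (var∘⊠⇒++ Γ Δ _) (≡⇒≈ (cong project (split-wkR {Γ} Δ x))))

  ++⇒⊠∘⊠⇒++ : ∀ Γ Δ → ++⇒⊠ Γ Δ ∘ ⊠⇒++ Γ Δ ≈ id
  ++⇒⊠∘⊠⇒++ Γ Δ = ⊠-ext
    (≈-trans (pullˡ (π₁-β _ _)) (≈-trans (π₁S∘⊠⇒++ Γ Δ) (≈-sym (idʳ π₁))))
    (≈-trans (pullˡ (π₂-β _ _)) (≈-trans (π₂S∘⊠⇒++ Γ Δ) (≈-sym (idʳ π₂))))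

  ⊠⇒++-ε : ∀ Γ → ⊠⇒++ Γ ε ≈ π₁
  ⊠⇒++-ε Γ = vars-jointly-monic Γ _ _ (var∘⊠⇒++ Γ ε)

  canon≈⊠⇒++ : ∀ Γ σ → canon S Γ σ ≈ ⊠⇒++ Γ (ε ▷ σ)
  canon≈⊠⇒++ Γ σ = vars-jointly-monic (Γ ▷ σ) _ _ componentwise
    where
    componentwise : ∀ {τ} (x : (Γ ▷ σ) ∋ τ) → ⟦ x ⟧ᵛ ∘ canon S Γ σ ≈ ⟦ x ⟧ᵛ ∘ ⊠⇒++ Γ (ε ▷ σ)
    componentwise here =
      ≈-trans (canon-here Γ σ) (≈-sym (≈-trans (var∘⊠⇒++ Γ (ε ▷ σ) here) (idˡ π₂)))
    componentwise (there y) =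
      ≈-trans (canon-there Γ σ y) (≈-sym (var∘⊠⇒++ Γ (ε ▷ σ) (there y)))

  project-there : ∀ Γ Δ τ {σ} (s : (Γ ∋ σ) ⊎ ((Δ ▷ τ) ∋ σ)) {υ}
                  → project {Γ} {Δ ▷ τ} s ∘ ⟨ π₁ , π₁ ∘ π₂ {⟦ Γ ⟧ᶜ} {⟦ Δ ▷ τ ⟧ᶜ ⊠ sortI υ} ⟩
                    ≈ project {Γ} {Δ ▷ τ ▷ υ} (Sum.map₂ there s)
  project-there Γ Δ τ (inj₁ x) = pullʳ (π₁-β _ _)
  project-there Γ Δ τ (inj₂ x) = ≈-trans (pullʳ (π₂-β _ _)) (sym-assoc _ _ _)

  ⊠⇒++-▷ : ∀ Γ Δ τ υ → (canon S (Γ ++ (Δ ▷ τ)) υ ∘ (⊠⇒++ Γ (Δ ▷ τ) ⊠m id)) ∘ assocM ≈ ⊠⇒++ Γ (Δ ▷ τ ▷ υ)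
  ⊠⇒++-▷ Γ Δ τ υ = vars-jointly-monic (Γ ++ (Δ ▷ τ) ▷ υ) _ _ componentwise
    where
    A = ⊠⇒++ Γ (Δ ▷ τ)
    componentwise : ∀ {σ} (x : (Γ ++ (Δ ▷ τ) ▷ υ) ∋ σ)
                    → ⟦ x ⟧ᵛ ∘ ((canon S (Γ ++ (Δ ▷ τ)) υ ∘ (A ⊠m id)) ∘ assocM) ≈ ⟦ x ⟧ᵛ ∘ ⊠⇒++ Γ (Δ ▷ τ ▷ υ)
    componentwise here = begin⟨ homSetoid ⟩
      ⟦ here {Γ = Γ ++ (Δ ▷ τ)} ⟧ᵛ ∘ ((canon S (Γ ++ (Δ ▷ τ)) υ ∘ (A ⊠m id)) ∘ assocM)
        ≈⟨ pullˡ (pullˡ (canon-here (Γ ++ (Δ ▷ τ)) υ)) ⟩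
      (π₂ ∘ (A ⊠m id)) ∘ assocM  ≈⟨ ≈-trans (π₂-β _ _) (idˡ π₂) ⟩∘⟨refl ⟩
      π₂ ∘ assocM                ≈⟨ π₂-β _ _ ⟩
      π₂ ∘ π₂                    ≈⟨ var∘⊠⇒++ Γ (Δ ▷ τ ▷ υ) here ⟨
      ⟦ here {Γ = Γ ++ (Δ ▷ τ)} ⟧ᵛ ∘ ⊠⇒++ Γ (Δ ▷ τ ▷ υ) ∎
    componentwise (there z) = begin⟨ homSetoid ⟩
      ⟦ there {τ = υ} z ⟧ᵛ ∘ ((canon S (Γ ++ (Δ ▷ τ)) υ ∘ (A ⊠m id)) ∘ assocM)
        ≈⟨ pullˡ (pullˡ (canon-there (Γ ++ (Δ ▷ τ)) υ z)) ⟩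
      ((⟦ z ⟧ᵛ ∘ π₁) ∘ (A ⊠m id)) ∘ assocM  ≈⟨ pullʳ (π₁-β _ _) ⟩∘⟨refl ⟩
      (⟦ z ⟧ᵛ ∘ (A ∘ π₁)) ∘ assocM          ≈⟨ ≈-trans (sym-assoc _ _ _ ⟩∘⟨refl) (∘-assoc _ _ _) ⟩
      (⟦ z ⟧ᵛ ∘ A) ∘ (π₁ ∘ assocM)          ≈⟨ ∘-resp (var∘⊠⇒++ Γ (Δ ▷ τ) z) (π₁-β _ _) ⟩
      project (split (Δ ▷ τ) z) ∘ ⟨ π₁ , π₁ ∘ π₂ ⟩ ≈⟨ project-there Γ Δ τ (split (Δ ▷ τ) z) ⟩
      project (Sum.map₂ there (split (Δ ▷ τ) z)) ≈⟨ var∘⊠⇒++ Γ (Δ ▷ τ ▷ υ) (there z) ⟨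
      ⟦ there {τ = υ} z ⟧ᵛ ∘ ⊠⇒++ Γ (Δ ▷ τ ▷ υ) ∎

  -- ⟦ Δ ▷ τ ⟧ᶜ is ⟦ Δ ⟧ᶜ ⊠ sortI τ only for nonempty Δ; for Δ = ε, Ω-unit replaces Ω-assoc.
  Ω-snoc : ∀ q Γ Δ τ (φ : Fm (Γ ++ Δ ▷ τ))
           → Ω q ⟦ Γ ⟧ᶜ ⟦ Δ ⟧ᶜ (Ω q (⟦ Γ ⟧ᶜ ⊠ ⟦ Δ ⟧ᶜ) (sortI τ)
                                 (Pmap (canon S (Γ ++ Δ) τ ∘ (⊠⇒++ Γ Δ ⊠m id)) ⟦ φ ⟧ᶠ))
             ≃ Ω q ⟦ Γ ⟧ᶜ ⟦ Δ ▷ τ ⟧ᶜ (Pmap (⊠⇒++ Γ (Δ ▷ τ)) ⟦ φ ⟧ᶠ)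
  Ω-snoc q Γ ε τ φ = begin⟨ predSetoid ⟩
    Ω q ⟦ Γ ⟧ᶜ 𝟙 (Ω q (⟦ Γ ⟧ᶜ ⊠ 𝟙) (sortI τ) (Pmap (canon S Γ τ ∘ (⊠⇒++ Γ ε ⊠m id)) ⟦ φ ⟧ᶠ))
      ≈⟨ Ω-resp q _ _ (Ω-resp q _ _ (≃-trans (Pmap-resp canon∘⊠⇒++ _) (Pmap-∘ _ _ _))) ⟩
    Ω q ⟦ Γ ⟧ᶜ 𝟙 (Ω q (⟦ Γ ⟧ᶜ ⊠ 𝟙) (sortI τ) (Pmap (π₁ ⊠m id) (Pmap (⊠⇒++ Γ (ε ▷ τ)) ⟦ φ ⟧ᶠ)))
      ≈⟨ Ω-resp q _ _ (Ω-nat q (sortI τ) π₁ _) ⟨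
    Ω q ⟦ Γ ⟧ᶜ 𝟙 (Pmap π₁ (Ω q ⟦ Γ ⟧ᶜ (sortI τ) (Pmap (⊠⇒++ Γ (ε ▷ τ)) ⟦ φ ⟧ᶠ)))
      ≈⟨ Ω-unit q _ _ ⟩
    Ω q ⟦ Γ ⟧ᶜ (sortI τ) (Pmap (⊠⇒++ Γ (ε ▷ τ)) ⟦ φ ⟧ᶠ) ∎
    where
    canon∘⊠⇒++ : canon S Γ τ ∘ (⊠⇒++ Γ ε ⊠m id) ≈ ⊠⇒++ Γ (ε ▷ τ) ∘ (π₁ ⊠m id)
    canon∘⊠⇒++ = ∘-resp (canon≈⊠⇒++ Γ τ) (⊠m-cong (⊠⇒++-ε Γ) ≈-refl)
  Ω-snoc q Γ (Δ ▷ υ) τ φ = ≃-trans (≃-sym (Ω-assoc q ⟦ Γ ⟧ᶜ ⟦ Δ ▷ υ ⟧ᶜ (sortI τ) _))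
    (Ω-resp q _ _ (≃-trans (≃-sym (Pmap-∘ _ _ _)) (Pmap-resp (⊠⇒++-▷ Γ Δ υ τ) _)))

  fmI-quantAll : ∀ q Γ Δ (φ : Fm (Γ ++ Δ)) → ⟦ quantAll q Δ φ ⟧ᶠ ≃ Ω q ⟦ Γ ⟧ᶜ ⟦ Δ ⟧ᶜ (Pmap (⊠⇒++ Γ Δ) ⟦ φ ⟧ᶠ)
  fmI-quantAll q Γ ε φ = ≃-sym (≃-trans (Ω-resp q _ _ (Pmap-resp (⊠⇒++-ε Γ) _)) (Ω-unit q _ _))
  fmI-quantAll q Γ (Δ ▷ τ) φ = begin⟨ predSetoid ⟩
    ⟦ quantAll q Δ (quant q τ φ) ⟧ᶠ
      ≈⟨ fmI-quantAll q Γ Δ (quant q τ φ) ⟩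
    Ω q ⟦ Γ ⟧ᶜ ⟦ Δ ⟧ᶜ (Pmap (⊠⇒++ Γ Δ) (Ω q ⟦ Γ ++ Δ ⟧ᶜ (sortI τ) (Pmap (canon S (Γ ++ Δ) τ) ⟦ φ ⟧ᶠ)))
      ≈⟨ Ω-resp q _ _ (Ω-nat q (sortI τ) (⊠⇒++ Γ Δ) _) ⟩
    Ω q ⟦ Γ ⟧ᶜ ⟦ Δ ⟧ᶜ (Ω q (⟦ Γ ⟧ᶜ ⊠ ⟦ Δ ⟧ᶜ) (sortI τ)
                         (Pmap (⊠⇒++ Γ Δ ⊠m id) (Pmap (canon S (Γ ++ Δ) τ) ⟦ φ ⟧ᶠ)))
      ≈⟨ Ω-resp q _ _ (Ω-resp q _ _ (Pmap-∘ _ _ _)) ⟨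
    Ω q ⟦ Γ ⟧ᶜ ⟦ Δ ⟧ᶜ (Ω q (⟦ Γ ⟧ᶜ ⊠ ⟦ Δ ⟧ᶜ) (sortI τ) (Pmap (canon S (Γ ++ Δ) τ ∘ (⊠⇒++ Γ Δ ⊠m id)) ⟦ φ ⟧ᶠ))
      ≈⟨ Ω-snoc q Γ Δ τ φ ⟩
    Ω q ⟦ Γ ⟧ᶜ ⟦ Δ ▷ τ ⟧ᶜ (Pmap (⊠⇒++ Γ (Δ ▷ τ)) ⟦ φ ⟧ᶠ) ∎

  π₁S∘weakenBoth : ∀ Γ τ σ → ⟦ π₁S {Γ ▷ τ} {Γ ▷ τ} ⟧ˢ ∘ ⟦ weakenBoth {Γ ▷ τ} {σ} ⟧ˢ
                             ≈ π₁ ∘ ⟦ π₁S {Γ ▷ τ ▷ σ} {Γ ▷ τ ▷ σ} ⟧ˢ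
  π₁S∘weakenBoth Γ τ σ = vars-jointly-monic (Γ ▷ τ) _ _ λ x → begin⟨ homSetoid ⟩
    ⟦ x ⟧ᵛ ∘ (⟦ π₁S {Γ ▷ τ} {Γ ▷ τ} ⟧ˢ ∘ ⟦ ρ ⟧ˢ)  ≈⟨ pullˡ (var∘π₁S (Γ ▷ τ) (Γ ▷ τ) x) ⟩
    ⟦ wkL {Δ = Γ ▷ τ} x ⟧ᵛ ∘ ⟦ ρ ⟧ˢ                ≈⟨ var∘tms≡ ρ _ (lookup-weakenBoth-wkL (Γ ▷ τ) σ x) ⟩
    ⟦ wkL {Δ = Γ ▷ τ ▷ σ} (there x) ⟧ᵛ                ≈⟨ var∘π₁S Γ⁺ Γ⁺ (there x) ⟨
    ⟦ there {τ = σ} x ⟧ᵛ ∘ ⟦ π₁S {Γ⁺} {Γ⁺} ⟧ˢ    ≈⟨ ∘-assoc _ _ _ ⟩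
    ⟦ x ⟧ᵛ ∘ (π₁ ∘ ⟦ π₁S {Γ⁺} {Γ⁺} ⟧ˢ)          ∎
    where
    Γ⁺ = Γ ▷ τ ▷ σ
    ρ : Tms (Γ⁺ ++ Γ⁺) (Γ ▷ τ ++ (Γ ▷ τ))
    ρ = weakenBoth {Γ ▷ τ} {σ}

  π₂S∘weakenBoth : ∀ Γ τ σ → ⟦ π₂S {Γ ▷ τ} {Γ ▷ τ} ⟧ˢ ∘ ⟦ weakenBoth {Γ ▷ τ} {σ} ⟧ˢ
                             ≈ π₁ ∘ ⟦ π₂S {Γ ▷ τ ▷ σ} {Γ ▷ τ ▷ σ} ⟧ˢ
  π₂S∘weakenBoth Γ τ σ = vars-jointly-monic (Γ ▷ τ) _ _ λ x → begin⟨ homSetoid ⟩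
    ⟦ x ⟧ᵛ ∘ (⟦ π₂S {Γ ▷ τ} {Γ ▷ τ} ⟧ˢ ∘ ⟦ ρ ⟧ˢ)  ≈⟨ pullˡ (var∘π₂S (Γ ▷ τ) (Γ ▷ τ) x) ⟩
    ⟦ wkR {Γ = Γ ▷ τ} x ⟧ᵛ ∘ ⟦ ρ ⟧ˢ                ≈⟨ var∘tms≡ ρ _ (lookup-weakenBoth-wkR (Γ ▷ τ) σ x) ⟩
    ⟦ wkR {Γ = Γ ▷ τ ▷ σ} (there x) ⟧ᵛ                ≈⟨ var∘π₂S Γ⁺ Γ⁺ (there x) ⟨
    ⟦ there {τ = σ} x ⟧ᵛ ∘ ⟦ π₂S {Γ⁺} {Γ⁺} ⟧ˢ    ≈⟨ ∘-assoc _ _ _ ⟩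
    ⟦ x ⟧ᵛ ∘ (π₁ ∘ ⟦ π₂S {Γ⁺} {Γ⁺} ⟧ˢ)          ∎
    where
    Γ⁺ = Γ ▷ τ ▷ σ
    ρ : Tms (Γ⁺ ++ Γ⁺) (Γ ▷ τ ++ (Γ ▷ τ))
    ρ = weakenBoth {Γ ▷ τ} {σ}

  ++⇒⊠∘weakenBoth : ∀ Γ τ σ → ++⇒⊠ (Γ ▷ τ) (Γ ▷ τ) ∘ ⟦ weakenBoth {Γ ▷ τ} {σ} ⟧ˢ
                              ≈ ⟨ π₁ ∘ π₁ , π₁ ∘ π₂ ⟩ ∘ ++⇒⊠ (Γ ▷ τ ▷ σ) (Γ ▷ τ ▷ σ)
  ++⇒⊠∘weakenBoth Γ τ σ = ≈-trans (⟨⟩∘ _ _ _) (≈-trans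
    (⟨⟩-cong₂ (≈-trans (π₁S∘weakenBoth Γ τ σ) (≈-sym (pullʳ (π₁-β _ _))))
              (≈-trans (π₂S∘weakenBoth Γ τ σ) (≈-sym (pullʳ (π₂-β _ _)))))
    (≈-sym (⟨⟩∘ _ _ _)))

  last-pair≈ : ∀ Γ τ σ
               → ⟨ ⟦ wkL {Δ = Γ ▷ τ ▷ σ} (here {Γ = Γ ▷ τ}) ⟧ᵛ , ⟦ wkR {Γ = Γ ▷ τ ▷ σ} (here {Γ = Γ ▷ τ}) ⟧ᵛ ⟩
                         ≈ ⟨ π₂ ∘ π₁ , π₂ ∘ π₂ ⟩ ∘ ++⇒⊠ (Γ ▷ τ ▷ σ) (Γ ▷ τ ▷ σ)
  last-pair≈ Γ τ σ = ≈-trans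
    (⟨⟩-cong₂ (≈-trans (≈-sym (var∘π₁S (Γ ▷ τ ▷ σ) (Γ ▷ τ ▷ σ) here)) (≈-sym (pullʳ (π₁-β _ _))))
              (≈-trans (≈-sym (var∘π₂S (Γ ▷ τ ▷ σ) (Γ ▷ τ ▷ σ) here)) (≈-sym (pullʳ (π₂-β _ _)))))
    (≈-sym (⟨⟩∘ _ _ _))

  fmI-eqFm : ∀ Γ → ⟦ eqFm Γ ⟧ᶠ ≃ Pmap (++⇒⊠ Γ Γ) (Eq ⟦ Γ ⟧ᶜ)
  fmI-eqFm ε = ≃-sym (≃-trans (Pmap-cong _ Eq-𝟙) (Pmap-e _))
  fmI-eqFm (ε ▷ σ) = ≃-refl
  fmI-eqFm (Γ ▷ τ ▷ σ) = begin⟨ predSetoid ⟩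
    ⟦ eqFm (Γ ▷ τ ▷ σ) ⟧ᶠ
      ≈⟨ ≡⇒≃ (cong (⟦_⟧ᶠ {Γ ▷ τ ▷ σ ++ (Γ ▷ τ ▷ σ)}) (eqFm-▷ (Γ ▷ τ) σ)) ⟩
    ⟦ bigF (List.map (subF ρ) atoms List.∷ʳ lastAtom) ⟧ᶠ
      ≈⟨ fmI-bigF-∷ʳ (List.map (subF ρ) atoms) lastAtom ⟩
    ⟦ bigF (List.map (subF ρ) atoms) ⟧ᶠ ⊗P ⟦ lastAtom ⟧ᶠ
      ≈⟨ ⊗-cong (≡⇒≃ (cong (⟦_⟧ᶠ {Γ ▷ τ ▷ σ ++ (Γ ▷ τ ▷ σ)}) eqFm-weakenBoth)) ≃-refl ⟩
    ⟦ subF ρ (eqFm (Γ ▷ τ)) ⟧ᶠ ⊗P ⟦ lastAtom ⟧ᶠ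
      ≈⟨ ⊗-cong (≃-trans (fmI-subF ρ (eqFm (Γ ▷ τ))) (Pmap-cong ⟦ ρ ⟧ˢ (fmI-eqFm (Γ ▷ τ)))) ≃-refl ⟩
    Pmap ⟦ ρ ⟧ˢ (Pmap (++⇒⊠ (Γ ▷ τ) (Γ ▷ τ)) (Eq ⟦ Γ ▷ τ ⟧ᶜ)) ⊗P ⟦ lastAtom ⟧ᶠ
      ≈⟨ ⊗-cong (≃-trans (≃-sym (Pmap-∘ (++⇒⊠ (Γ ▷ τ) (Γ ▷ τ)) ⟦ ρ ⟧ˢ _)) (Pmap-resp (++⇒⊠∘weakenBoth Γ τ σ) _))
                (Pmap-resp (last-pair≈ Γ τ σ) _) ⟩
    Pmap (⟨ π₁ ∘ π₁ , π₁ ∘ π₂ ⟩ ∘ ++⇒⊠ (Γ ▷ τ ▷ σ) (Γ ▷ τ ▷ σ)) (Eq ⟦ Γ ▷ τ ⟧ᶜ)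
      ⊗P Pmap (⟨ π₂ ∘ π₁ , π₂ ∘ π₂ ⟩ ∘ ++⇒⊠ (Γ ▷ τ ▷ σ) (Γ ▷ τ ▷ σ)) (Eq (sortI σ))
      ≈⟨ Pmap-Eq-⊠ (++⇒⊠ (Γ ▷ τ ▷ σ) (Γ ▷ τ ▷ σ)) ⟩
    Pmap (++⇒⊠ (Γ ▷ τ ▷ σ) (Γ ▷ τ ▷ σ)) (Eq ⟦ Γ ▷ τ ▷ σ ⟧ᶜ) ∎
    where
    ρ : Tms (Γ ▷ τ ▷ σ ++ (Γ ▷ τ ▷ σ)) (Γ ▷ τ ++ (Γ ▷ τ))
    ρ = weakenBoth {Γ ▷ τ} {σ}
    atoms : List (Fm (Γ ▷ τ ++ (Γ ▷ τ)))
    atoms = List.map (eqAtom (Γ ▷ τ)) (allVars (Γ ▷ τ))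
    lastAtom : Fm (Γ ▷ τ ▷ σ ++ (Γ ▷ τ ▷ σ))
    lastAtom = eqAtom (Γ ▷ τ ▷ σ) (σ , here)
    eqFm-weakenBoth : bigF (List.map (subF ρ) atoms) ≡ subF ρ (eqFm (Γ ▷ τ))
    eqFm-weakenBoth = trans (sym (subF-bigF ρ atoms)) (cong (subF ρ) (sym (eqFm≡bigF-eqAtom (Γ ▷ τ))))

module ComparisonMaps {ℒ : Language} {Sg : Signature} {o h e p r o′ h′ e′ p′ r′ : Level}
                      {X : FA ℒ o h e p r} {Y : FA ℒ o′ h′ e′ p′ r′}
                      (F : FAMor X Y) (S : Interp.Structure ℒ Sg (FA.raw X)) where
  open Signature Sg
  open FAMor F
  open Interp.Structure S
  private
    module Y = FA Y
    module IX = Interp ℒ Sg (FA.raw X)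
    module IY = Interp ℒ Sg (FA.raw Y)

  -- applyS keeps its comparison maps a_Γ⁻¹ local; unification with funI recovers them.
  comparison-spec : Σ (∀ Γ → Y.Hom (IY.ctxObj (λ σ → Fo (sortI σ)) Γ) (Fo (IX.ctxObj sortI Γ)))
                      (λ a → ∀ {Δ τ} (f : Fun Δ τ) → IY.Structure.funI (applyS F S) f ≡ Fh (funI f) Y.∘ a Δ)
  comparison-spec = _ , λ f → refl

  comparison : ∀ Γ → Y.Hom (IY.ctxObj (λ σ → Fo (sortI σ)) Γ) (Fo (IX.ctxObj sortI Γ))
  comparison = proj₁ comparison-spec

module GenericModel (ℒ : Language) (Sg : Signature) (T : Syntax.Theory ℒ Sg) where
  open Syntax ℒ Sg
  open SyntaxProperties ℒ Sg
  open Signature Sg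
  open Interp ℒ Sg (Classifying.rawCT ℒ Sg T) using (ctxObj; Structure; module Structure)

  G : Structure
  G = generic ℒ Sg T

  -- ⟦ Δ ⟧ᴳ is Δ rebuilt from one-variable contexts: equal to Δ, but not definitionally,
  -- whence toᴳ and fromᴳ.
  ⟦_⟧ᴳ : Cx → Cx
  ⟦ Δ ⟧ᴳ = ctxObj (Structure.sortI G) Δ

  -- As for applyS, the variable lists of generic are recovered by unification.
  genericVars-spec : Σ (∀ Δ → Tms ⟦ Δ ⟧ᴳ Δ)
                       (λ vars → ∀ {Δ τ} (f : Fun Δ τ) → Structure.funI G f ≡ (ε , app f (vars Δ)))
  genericVars-spec = _ , λ f → refl

  genericVars : ∀ Δ → Tms ⟦ Δ ⟧ᴳ Δ
  genericVars = proj₁ genericVars-spec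

  toᴳ : ∀ Δ {σ} → Δ ∋ σ → ⟦ Δ ⟧ᴳ ∋ σ
  toᴳ (ε ▷ σ) here = here
  toᴳ (Δ ▷ τ ▷ σ) here = here
  toᴳ (Δ ▷ τ ▷ σ) (there x) = there (toᴳ (Δ ▷ τ) x)

  fromᴳ : ∀ Δ {σ} → ⟦ Δ ⟧ᴳ ∋ σ → Δ ∋ σ
  fromᴳ (ε ▷ σ) here = here
  fromᴳ (Δ ▷ τ ▷ σ) here = here
  fromᴳ (Δ ▷ τ ▷ σ) (there v) = there (fromᴳ (Δ ▷ τ) v)

  fromᴳ-toᴳ : ∀ Δ {σ} (x : Δ ∋ σ) → fromᴳ Δ (toᴳ Δ x) ≡ x
  fromᴳ-toᴳ (ε ▷ σ) here = refl
  fromᴳ-toᴳ (Δ ▷ τ ▷ σ) here = refl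
  fromᴳ-toᴳ (Δ ▷ τ ▷ σ) (there x) = cong there (fromᴳ-toᴳ (Δ ▷ τ) x)

  toᴳ-fromᴳ : ∀ Δ {σ} (v : ⟦ Δ ⟧ᴳ ∋ σ) → toᴳ Δ (fromᴳ Δ v) ≡ v
  toᴳ-fromᴳ (ε ▷ σ) here = refl
  toᴳ-fromᴳ (Δ ▷ τ ▷ σ) here = refl
  toᴳ-fromᴳ (Δ ▷ τ ▷ σ) (there v) = cong there (toᴳ-fromᴳ (Δ ▷ τ) v)

  lookup-genericVars : ∀ Δ {σ} (x : Δ ∋ σ) → lookup (genericVars Δ) x ≡ var (toᴳ Δ x)
  lookup-genericVars (ε ▷ σ) here = refl
  lookup-genericVars (Δ ▷ τ ▷ σ) here = refl
  lookup-genericVars (Δ ▷ τ ▷ σ) (there x) =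
    trans (lookup-renTs there (genericVars (Δ ▷ τ)) x) (cong (renT there) (lookup-genericVars (Δ ▷ τ) x))

  reindexᴳ : ∀ {Γ Δ} → Tms Γ Δ → Tms Γ ⟦ Δ ⟧ᴳ
  reindexᴳ {Δ = Δ} ts = tab (λ v → lookup ts (fromᴳ Δ v))

  lookup-reindexᴳ : ∀ {Γ Δ σ} (ts : Tms Γ Δ) (x : Δ ∋ σ) → lookup (reindexᴳ ts) (toᴳ Δ x) ≡ lookup ts x
  lookup-reindexᴳ {Δ = Δ} ts x =
    trans (lookup-tab (λ v → lookup ts (fromᴳ Δ v)) (toᴳ Δ x)) (cong (lookup ts) (fromᴳ-toᴳ Δ x))

  genericVars-reindexᴳ : ∀ {Γ Δ} (ts : Tms Γ Δ) → subTs (reindexᴳ ts) (genericVars Δ) ≡ ts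
  genericVars-reindexᴳ {Δ = Δ} ts = Tms-ext _ _ λ x → trans (lookup-subTs (reindexᴳ ts) (genericVars Δ) x)
    (trans (cong (subT (reindexᴳ ts)) (lookup-genericVars Δ x)) (lookup-reindexᴳ ts x))

module Existence (ℒ : Language) (L : Logic ℒ) (adq : Adequate ℒ L) (Sg : Signature) (T : Syntax.Theory ℒ Sg)
                 (isT : IsLTheory ℒ L Sg T) {o h e p r : Level} (X : FA ℒ o h e p r)
                 (S : Interp.Structure ℒ Sg (FA.raw X)) (S⊨T : Interp.IsModel ℒ Sg (FA.raw X) S T) where
  open FAProperties X
  open Semantics X S
  open Interp ℒ Sg (FA.raw X) using (ctxObj-cong; Structure; module Structure; StrEq)
  open Structure S
  open Syntax ℒ Sg
  open GenericModel ℒ Sg T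
  open MultiSetoidReasoning

  tmsI-resp : ∀ {Γ Δ} {ρ ρ′ : Tms Γ Δ} → TmsEq T ρ ρ′ → ⟦ ρ ⟧ˢ ≈ ⟦ ρ′ ⟧ˢ
  tmsI-resp {Δ = Δ} {ρ} {ρ′} ρ≈ρ′ = vars-jointly-monic Δ _ _ λ x →
    ≈-trans (var∘tms ρ x) (≈-trans (lower (S⊨T _ (lookup-eq ρ ρ′ ρ≈ρ′ x))) (≈-sym (var∘tms ρ′ x)))
    where
    lookup-eq : ∀ {Γ Δ σ} (ρ ρ′ : Tms Γ Δ) → TmsEq T ρ ρ′ → (x : Δ ∋ σ)
                → T (eqn Γ σ (lookup ρ x) (lookup ρ′ x))
    lookup-eq (ρ , s) (ρ′ , t) (_ , s≈t) here = s≈t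
    lookup-eq (ρ , s) (ρ′ , t) (ρ≈ρ′ , _) (there x) = lookup-eq ρ ρ′ ρ≈ρ′ x

  interpretation : FAMor (CT ℒ L adq Sg T isT) X
  interpretation = record
    { Fo      = ⟦_⟧ᶜ
    ; Fh      = ⟦_⟧ˢ
    ; Fh-resp = tmsI-resp
    ; Fh-id   = λ {Γ} → tmsI-idS {Γ}
    ; Fh-∘    = λ g f → tmsI-subTs f g
    ; 𝟙-inv   = id
    ; 𝟙-iso₁  = !-ext _ _
    ; 𝟙-iso₂  = !-ext _ _
    ; ×-inv   = λ {Γ} {Δ} → ⊠⇒++ Γ Δ
    ; ×-iso₁  = λ {Γ} {Δ} → ⊠⇒++∘++⇒⊠ Γ Δ
    ; ×-iso₂  = λ {Γ} {Δ} → ++⇒⊠∘⊠⇒++ Γ Δ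
    ; Fp      = ⟦_⟧ᶠ
    ; Fp-mono = λ φ⊢ψ → lower (S⊨T _ φ⊢ψ)
    ; Fp-nat  = fmI-subF
    ; Fp-op   = λ k φs → ≡⇒≃ (cong (op k) (fmIs≡map φs))
    ; Fp-Ω    = fmI-quantAll
    ; Fp-Eq   = fmI-eqFm
    }

  open ComparisonMaps interpretation G

  var∘comparison : ∀ Δ {σ} (x : Δ ∋ σ) → ⟦ toᴳ Δ x ⟧ᵛ ∘ comparison Δ ≈ ⟦ x ⟧ᵛ
  var∘comparison (ε ▷ σ) here = idˡ _
  var∘comparison (Δ ▷ τ ▷ σ) here = begin⟨ homSetoid ⟩
    ⟦ here {Γ = ⟦ Δ ▷ τ ⟧ᴳ} ⟧ᵛ ∘ (⊠⇒++ ⟦ Δ ▷ τ ⟧ᴳ (ε ▷ σ) ∘ (comparison (Δ ▷ τ) ⊠m id))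
      ≈⟨ pullˡ (≈-trans (var∘⊠⇒++ ⟦ Δ ▷ τ ⟧ᴳ (ε ▷ σ) here) (idˡ _)) ⟩
    π₂ ∘ (comparison (Δ ▷ τ) ⊠m id) ≈⟨ π₂-β _ _ ⟩
    id ∘ π₂                         ≈⟨ idˡ _ ⟩
    π₂                              ∎
  var∘comparison (Δ ▷ τ ▷ σ) (there y) = begin⟨ homSetoid ⟩
    ⟦ there {τ = σ} (toᴳ (Δ ▷ τ) y) ⟧ᵛ ∘ (⊠⇒++ ⟦ Δ ▷ τ ⟧ᴳ (ε ▷ σ) ∘ (comparison (Δ ▷ τ) ⊠m id))
      ≈⟨ pullˡ (var∘⊠⇒++ ⟦ Δ ▷ τ ⟧ᴳ (ε ▷ σ) (there (toᴳ (Δ ▷ τ) y))) ⟩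
    (⟦ toᴳ (Δ ▷ τ) y ⟧ᵛ ∘ π₁) ∘ (comparison (Δ ▷ τ) ⊠m id) ≈⟨ pullʳ (π₁-β _ _) ⟩
    ⟦ toᴳ (Δ ▷ τ) y ⟧ᵛ ∘ (comparison (Δ ▷ τ) ∘ π₁)        ≈⟨ pullˡ (var∘comparison (Δ ▷ τ) y) ⟩
    ⟦ y ⟧ᵛ ∘ π₁                                          ∎

  genericVars∘comparison : ∀ Δ → ⟦ genericVars Δ ⟧ˢ ∘ comparison Δ ≈ id
  genericVars∘comparison Δ = vars-jointly-monic Δ _ _ λ x → begin⟨ homSetoid ⟩
    ⟦ x ⟧ᵛ ∘ (⟦ genericVars Δ ⟧ˢ ∘ comparison Δ)
      ≈⟨ pullˡ (var∘tms≡ (genericVars Δ) x (lookup-genericVars Δ x)) ⟩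
    ⟦ toᴳ Δ x ⟧ᵛ ∘ comparison Δ                 ≈⟨ var∘comparison Δ x ⟩
    ⟦ x ⟧ᵛ                                      ≈⟨ idʳ _ ⟨
    ⟦ x ⟧ᵛ ∘ id                                 ∎

  ctxObj-cong-refl : ∀ Δ → ctxObj-cong {I = sortI} {J = sortI} (λ σ → refl) Δ ≡ refl
  ctxObj-cong-refl ε = refl
  ctxObj-cong-refl (ε ▷ σ) = refl
  ctxObj-cong-refl (Δ ▷ τ ▷ σ) rewrite ctxObj-cong-refl (Δ ▷ τ) = refl

  interpretation-generic : StrEq (applyS interpretation G) S
  interpretation-generic = record
    { sortEq = λ σ → refl
    ; funEq  = λ {Δ} f → subst (λ eq → subst₂ Hom eq refl (Structure.funI (applyS interpretation G) f) ≈ funI f)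
                 (sym (ctxObj-cong-refl Δ))
                 (≈-trans (pullʳ (genericVars∘comparison Δ)) (idʳ _))
    ; relEq  = λ {Δ} R → subst (λ eq → subst P eq (Structure.relI (applyS interpretation G) R) ≃ relI R)
                 (sym (ctxObj-cong-refl Δ))
                 (≃-trans (≃-sym (Pmap-∘ _ _ _)) (≃-trans (Pmap-resp (genericVars∘comparison Δ) _) (Pmap-id _)))
    }

module Uniqueness (ℒ : Language) (L : Logic ℒ) (adq : Adequate ℒ L) (Sg : Signature) (T : Syntax.Theory ℒ Sg)
                  (isT : IsLTheory ℒ L Sg T) {o h e p r : Level} (X : FA ℒ o h e p r)
                  (S : Interp.Structure ℒ Sg (FA.raw X))
                  (F : FAMor (CT ℒ L adq Sg T isT) X)
                  (F[G]≡S : Interp.StrEq ℒ Sg (FA.raw X) (applyS F (generic ℒ Sg T)) S) where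
  open FAProperties X
  open Semantics X S
  open Interp ℒ Sg (FA.raw X) using (varI; canon; fmIs; ctxObj; ctxObj-cong; module Structure; module StrEq)
  open Structure S
  open Syntax ℒ Sg
  open SyntaxProperties ℒ Sg
  open Signature Sg
  open GenericModel ℒ Sg T
  open MultiSetoidReasoning
  module F = FAMor F
  open ComparisonMaps F G

  sortEq : ∀ σ → F.Fo (ε ▷ σ) ≡ sortI σ
  sortEq = StrEq.sortEq F[G]≡S

  θ : ∀ σ → Hom (F.Fo (ε ▷ σ)) (sortI σ)
  θ σ = idToHom (sortEq σ)

  θ⁻¹ : ∀ σ → Hom (sortI σ) (F.Fo (ε ▷ σ))
  θ⁻¹ σ = idToHom (sym (sortEq σ))

  θ⁻¹∘θ : ∀ σ → θ⁻¹ σ ∘ θ σ ≈ id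
  θ⁻¹∘θ σ = idToHom-symˡ (sortEq σ)

  θ∘θ⁻¹ : ∀ σ → θ σ ∘ θ⁻¹ σ ≈ id
  θ∘θ⁻¹ σ = idToHom-symʳ (sortEq σ)

  ctxEq : ∀ Δ → ctxObj (λ σ → F.Fo (ε ▷ σ)) Δ ≡ ⟦ Δ ⟧ᶜ
  ctxEq = ctxObj-cong sortEq

  ⟦_⟧ᵛᶠ : ∀ {Γ σ} → Γ ∋ σ → Hom (ctxObj (λ σ → F.Fo (ε ▷ σ)) Γ) (F.Fo (ε ▷ σ))
  ⟦ x ⟧ᵛᶠ = varI (applyS F G) x

  Fvar : ∀ {Θ σ} → Θ ∋ σ → Hom (F.Fo Θ) (F.Fo (ε ▷ σ))
  Fvar v = F.Fh (ε , var v)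

  Fvar-there : ∀ {Θ σ τ} (v : Θ ∋ τ) → Fvar (there {τ = σ} v) ≈ Fvar v ∘ F.Fh (π₁S {Θ} {ε ▷ σ})
  Fvar-there {Θ} {σ} v =
    ≈-trans (≡⇒≈ (cong (λ t → F.Fh (ε , t)) (sym (lookup-tab (λ y → var (there {τ = σ} y)) v))))
            (F.Fh-∘ (ε , var v) (π₁S {Θ} {ε ▷ σ}))

  Fπ₁∘×-inv : ∀ {Θ σ} → F.Fh (π₁S {Θ} {ε ▷ σ}) ∘ F.×-inv {Θ} {ε ▷ σ} ≈ π₁
  Fπ₁∘×-inv = ≈-trans (≈-sym (π₁-β _ _) ⟩∘⟨refl) (≈-trans (pullʳ F.×-iso₂) (idʳ π₁))

  Fπ₂∘×-inv : ∀ {Θ σ} → F.Fh (π₂S {Θ} {ε ▷ σ}) ∘ F.×-inv {Θ} {ε ▷ σ} ≈ π₂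
  Fπ₂∘×-inv = ≈-trans (≈-sym (π₂-β _ _) ⟩∘⟨refl) (≈-trans (pullʳ F.×-iso₂) (idʳ π₂))

  Fvar-here∘×-inv : ∀ {Θ σ c} (k : Hom c (F.Fo Θ ⊠ F.Fo (ε ▷ σ)))
                    → Fvar {Θ ▷ σ} here ∘ (F.×-inv {Θ} {ε ▷ σ} ∘ k) ≈ π₂ ∘ k
  Fvar-here∘×-inv k = pullˡ Fπ₂∘×-inv

  Fvar-there∘×-inv : ∀ {Θ σ τ c} (v : Θ ∋ τ) (k : Hom c (F.Fo Θ ⊠ F.Fo (ε ▷ σ)))
                     → Fvar (there {τ = σ} v) ∘ (F.×-inv {Θ} {ε ▷ σ} ∘ k) ≈ Fvar v ∘ (π₁ ∘ k)
  Fvar-there∘×-inv v k =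
    ≈-trans (Fvar-there v ⟩∘⟨refl) (≈-trans (∘-assoc _ _ _) (refl⟩∘⟨ pullˡ Fπ₁∘×-inv))

  Fvars-jointly-monic : ∀ Θ {c} (k k′ : Hom c (F.Fo Θ))
                        → (∀ {σ} (v : Θ ∋ σ) → Fvar v ∘ k ≈ Fvar v ∘ k′) → k ≈ k′
  Fvars-jointly-monic ε k k′ _ = split-mono-cancel F.𝟙-iso₁ (!-ext _ _)
  Fvars-jointly-monic (Θ ▷ σ) k k′ same = split-mono-cancel (F.×-iso₁ {Θ} {ε ▷ σ})
    (≈-trans (⟨⟩∘ _ _ _) (≈-trans (⟨⟩-cong₂ (Fvars-jointly-monic Θ _ _ first) (same here)) (≈-sym (⟨⟩∘ _ _ _))))
    where
    first : ∀ {τ} (v : Θ ∋ τ) → Fvar v ∘ (F.Fh π₁S ∘ k) ≈ Fvar v ∘ (F.Fh π₁S ∘ k′)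
    first v = begin⟨ homSetoid ⟩
      Fvar v ∘ (F.Fh π₁S ∘ k)    ≈⟨ pullˡ (≈-sym (Fvar-there v)) ⟩
      Fvar (there v) ∘ k         ≈⟨ same (there v) ⟩
      Fvar (there v) ∘ k′        ≈⟨ pullˡ (≈-sym (Fvar-there v)) ⟨
      Fvar v ∘ (F.Fh π₁S ∘ k′)   ∎

  θ-transpose : ∀ {σ c} {f : Hom c (F.Fo (ε ▷ σ))} {g : Hom c (sortI σ)} → θ σ ∘ f ≈ g → f ≈ θ⁻¹ σ ∘ g
  θ-transpose {σ} {f = f} {g} θ∘f≈g = begin⟨ homSetoid ⟩
    f                   ≈⟨ idˡ f ⟨
    id ∘ f              ≈⟨ θ⁻¹∘θ σ ⟩∘⟨refl ⟨
    (θ⁻¹ σ ∘ θ σ) ∘ f   ≈⟨ pullʳ θ∘f≈g ⟩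
    θ⁻¹ σ ∘ g           ∎

  var∘ctxEq : ∀ Δ {σ} (x : Δ ∋ σ) → ⟦ x ⟧ᵛ ∘ idToHom (ctxEq Δ) ≈ θ σ ∘ ⟦ x ⟧ᵛᶠ
  var∘ctxEq (ε ▷ σ) here = ≈-trans (idˡ _) (≈-sym (idʳ _))
  var∘ctxEq (Δ ▷ τ ▷ σ) here = ≈-trans (refl⟩∘⟨ idToHom-⊠ (ctxEq (Δ ▷ τ)) (sortEq σ)) (π₂-β _ _)
  var∘ctxEq (Δ ▷ τ ▷ σ) (there y) = begin⟨ homSetoid ⟩
    (⟦ y ⟧ᵛ ∘ π₁) ∘ idToHom (ctxEq (Δ ▷ τ ▷ σ))        ≈⟨ pullʳ (refl⟩∘⟨ idToHom-⊠ (ctxEq (Δ ▷ τ)) (sortEq σ)) ⟩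
    ⟦ y ⟧ᵛ ∘ (π₁ ∘ (idToHom (ctxEq (Δ ▷ τ)) ⊠m θ σ))  ≈⟨ refl⟩∘⟨ π₁-β _ _ ⟩
    ⟦ y ⟧ᵛ ∘ (idToHom (ctxEq (Δ ▷ τ)) ∘ π₁)            ≈⟨ pullˡ (var∘ctxEq (Δ ▷ τ) y) ⟩
    (θ _ ∘ ⟦ y ⟧ᵛᶠ) ∘ π₁                               ≈⟨ ∘-assoc _ _ _ ⟩
    θ _ ∘ (⟦ y ⟧ᵛᶠ ∘ π₁)                               ∎

  varᶠ∘ctxEq⁻¹ : ∀ Δ {σ} (x : Δ ∋ σ) → ⟦ x ⟧ᵛᶠ ∘ idToHom (sym (ctxEq Δ)) ≈ θ⁻¹ σ ∘ ⟦ x ⟧ᵛ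
  varᶠ∘ctxEq⁻¹ Δ x = θ-transpose (begin⟨ homSetoid ⟩
    θ _ ∘ (⟦ x ⟧ᵛᶠ ∘ idToHom (sym (ctxEq Δ)))      ≈⟨ sym-assoc _ _ _ ⟩
    (θ _ ∘ ⟦ x ⟧ᵛᶠ) ∘ idToHom (sym (ctxEq Δ))      ≈⟨ var∘ctxEq Δ x ⟩∘⟨refl ⟨
    (⟦ x ⟧ᵛ ∘ idToHom (ctxEq Δ)) ∘ idToHom (sym (ctxEq Δ)) ≈⟨ pullʳ (idToHom-symʳ (ctxEq Δ)) ⟩
    ⟦ x ⟧ᵛ ∘ id                                   ≈⟨ idʳ _ ⟩
    ⟦ x ⟧ᵛ                                        ∎)

  varᶠ≈Fvar∘comparison : ∀ Δ {σ} (x : Δ ∋ σ) → ⟦ x ⟧ᵛᶠ ≈ Fvar (toᴳ Δ x) ∘ comparison Δ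
  varᶠ≈Fvar∘comparison (ε ▷ σ) here = ≈-sym (≈-trans (idʳ _) F.Fh-id)
  varᶠ≈Fvar∘comparison (Δ ▷ τ ▷ σ) here =
    ≈-sym (≈-trans (Fvar-here∘×-inv _) (≈-trans (π₂-β _ _) (idˡ _)))
  varᶠ≈Fvar∘comparison (Δ ▷ τ ▷ σ) (there y) = ≈-sym (begin⟨ homSetoid ⟩
    Fvar (there (toᴳ (Δ ▷ τ) y)) ∘ (F.×-inv ∘ (comparison (Δ ▷ τ) ⊠m id))
      ≈⟨ Fvar-there∘×-inv (toᴳ (Δ ▷ τ) y) _ ⟩
    Fvar (toᴳ (Δ ▷ τ) y) ∘ (π₁ ∘ (comparison (Δ ▷ τ) ⊠m id)) ≈⟨ refl⟩∘⟨ π₁-β _ _ ⟩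
    Fvar (toᴳ (Δ ▷ τ) y) ∘ (comparison (Δ ▷ τ) ∘ π₁)        ≈⟨ sym-assoc _ _ _ ⟩
    (Fvar (toᴳ (Δ ▷ τ) y) ∘ comparison (Δ ▷ τ)) ∘ π₁        ≈⟨ varᶠ≈Fvar∘comparison (Δ ▷ τ) y ⟩∘⟨refl ⟨
    ⟦ y ⟧ᵛᶠ ∘ π₁                                           ∎)

  ξ : ∀ Δ → Hom ⟦ Δ ⟧ᶜ (F.Fo ⟦ Δ ⟧ᴳ)
  ξ Δ = comparison Δ ∘ idToHom (sym (ctxEq Δ))

  Fvar∘ξ : ∀ Δ {σ} (x : Δ ∋ σ) → Fvar (toᴳ Δ x) ∘ ξ Δ ≈ θ⁻¹ σ ∘ ⟦ x ⟧ᵛ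
  Fvar∘ξ Δ x = ≈-trans (sym-assoc _ _ _)
    (≈-trans (≈-sym (varᶠ≈Fvar∘comparison Δ x) ⟩∘⟨refl) (varᶠ∘ctxEq⁻¹ Δ x))

  θ∘generic-fun : ∀ {Δ τ} (f : Fun Δ τ) → θ τ ∘ (F.Fh (ε , app f (genericVars Δ)) ∘ ξ Δ) ≈ funI f
  θ∘generic-fun {Δ} {τ} f = ≈-trans (refl⟩∘⟨ sym-assoc _ _ _)
    (≈-trans (≈-sym (subst₂-Hom (ctxEq Δ) (sortEq τ) _)) (StrEq.funEq F[G]≡S f))

  ξ-generic-rel : ∀ {Δ} (R : Rel Δ) → Pmap (ξ Δ) (F.Fp (rel R (genericVars Δ))) ≃ relI R
  ξ-generic-rel {Δ} R = ≃-trans (Pmap-∘ _ _ _)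
    (≃-trans (≃-sym (subst-P (ctxEq Δ) _)) (StrEq.relEq F[G]≡S R))

  η : ∀ Γ → Hom (F.Fo Γ) ⟦ Γ ⟧ᶜ
  η Γ = tuple Γ (λ {σ} x → θ σ ∘ Fvar x)

  var∘η : ∀ Γ {σ} (x : Γ ∋ σ) → ⟦ x ⟧ᵛ ∘ η Γ ≈ θ σ ∘ Fvar x
  var∘η Γ = tuple-β Γ _

  -- f(ts) is the generic f(x⃗) substituted by ts reindexed along ⟦ Δ ⟧ᴳ, so F on it factors
  -- through F on the generic term, which F(G) = S identifies with funI f.
  mutual
    η-tm : ∀ {Γ σ} (t : Tm Γ σ) → θ σ ∘ F.Fh (ε , t) ≈ ⟦ t ⟧ᵗ ∘ η Γ
    η-tm {Γ} (var x) = ≈-sym (var∘η Γ x)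
    η-tm {Γ} {τ} (app {Δ} f ts) = begin⟨ homSetoid ⟩
      θ τ ∘ F.Fh (ε , app f ts)
        ≈⟨ refl⟩∘⟨ ≡⇒≈ (cong (λ us → F.Fh (ε , app f us)) (sym (genericVars-reindexᴳ ts))) ⟩
      θ τ ∘ F.Fh (subTs (reindexᴳ ts) (ε , app f (genericVars Δ)))  ≈⟨ refl⟩∘⟨ F.Fh-∘ _ _ ⟩
      θ τ ∘ (F.Fh (ε , app f (genericVars Δ)) ∘ F.Fh (reindexᴳ ts))  ≈⟨ refl⟩∘⟨ refl⟩∘⟨ F-reindexᴳ ts ⟩
      θ τ ∘ (F.Fh (ε , app f (genericVars Δ)) ∘ (ξ Δ ∘ (⟦ ts ⟧ˢ ∘ η Γ)))
        ≈⟨ ≈-trans (refl⟩∘⟨ sym-assoc _ _ _) (sym-assoc _ _ _) ⟩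
      (θ τ ∘ (F.Fh (ε , app f (genericVars Δ)) ∘ ξ Δ)) ∘ (⟦ ts ⟧ˢ ∘ η Γ)  ≈⟨ θ∘generic-fun f ⟩∘⟨refl ⟩
      funI f ∘ (⟦ ts ⟧ˢ ∘ η Γ)  ≈⟨ sym-assoc _ _ _ ⟩
      (funI f ∘ ⟦ ts ⟧ˢ) ∘ η Γ  ∎

    η-lookup : ∀ {Γ Δ σ} (ts : Tms Γ Δ) (x : Δ ∋ σ) → θ σ ∘ F.Fh (ε , lookup ts x) ≈ ⟦ lookup ts x ⟧ᵗ ∘ η Γ
    η-lookup (ts , t) here = η-tm t
    η-lookup (ts , t) (there x) = η-lookup ts x

    F-reindexᴳ : ∀ {Γ Δ} (ts : Tms Γ Δ) → F.Fh (reindexᴳ ts) ≈ ξ Δ ∘ (⟦ ts ⟧ˢ ∘ η Γ)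
    F-reindexᴳ {Γ} {Δ} ts = Fvars-jointly-monic ⟦ Δ ⟧ᴳ _ _ λ v →
      subst (λ w → Fvar w ∘ F.Fh (reindexᴳ ts) ≈ Fvar w ∘ (ξ Δ ∘ (⟦ ts ⟧ˢ ∘ η Γ)))
            (toᴳ-fromᴳ Δ v) (componentwise (fromᴳ Δ v))
      where
      componentwise : ∀ {σ} (x : Δ ∋ σ)
                      → Fvar (toᴳ Δ x) ∘ F.Fh (reindexᴳ ts) ≈ Fvar (toᴳ Δ x) ∘ (ξ Δ ∘ (⟦ ts ⟧ˢ ∘ η Γ))
      componentwise {σ} x = begin⟨ homSetoid ⟩
        Fvar (toᴳ Δ x) ∘ F.Fh (reindexᴳ ts)       ≈⟨ F.Fh-∘ _ _ ⟨
        F.Fh (ε , lookup (reindexᴳ ts) (toᴳ Δ x))  ≈⟨ ≡⇒≈ (cong (λ t → F.Fh (ε , t)) (lookup-reindexᴳ ts x)) ⟩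
        F.Fh (ε , lookup ts x)                     ≈⟨ θ-transpose (η-lookup ts x) ⟩
        θ⁻¹ σ ∘ (⟦ lookup ts x ⟧ᵗ ∘ η Γ)           ≈⟨ refl⟩∘⟨ (var∘tms ts x ⟩∘⟨refl) ⟨
        θ⁻¹ σ ∘ ((⟦ x ⟧ᵛ ∘ ⟦ ts ⟧ˢ) ∘ η Γ)         ≈⟨ ≈-trans (refl⟩∘⟨ ∘-assoc _ _ _) (sym-assoc _ _ _) ⟩
        (θ⁻¹ σ ∘ ⟦ x ⟧ᵛ) ∘ (⟦ ts ⟧ˢ ∘ η Γ)         ≈⟨ Fvar∘ξ Δ x ⟩∘⟨refl ⟨
        (Fvar (toᴳ Δ x) ∘ ξ Δ) ∘ (⟦ ts ⟧ˢ ∘ η Γ)   ≈⟨ ∘-assoc _ _ _ ⟩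
        Fvar (toᴳ Δ x) ∘ (ξ Δ ∘ (⟦ ts ⟧ˢ ∘ η Γ))   ∎

  η-natural : ∀ {Γ Δ} (ρ : Tms Γ Δ) → η Δ ∘ F.Fh ρ ≈ ⟦ ρ ⟧ˢ ∘ η Γ
  η-natural {Γ} {Δ} ρ = vars-jointly-monic Δ _ _ λ {σ} x → begin⟨ homSetoid ⟩
    ⟦ x ⟧ᵛ ∘ (η Δ ∘ F.Fh ρ)         ≈⟨ pullˡ (var∘η Δ x) ⟩
    (θ σ ∘ Fvar x) ∘ F.Fh ρ         ≈⟨ pullʳ (≈-sym (F.Fh-∘ (ε , var x) ρ)) ⟩
    θ σ ∘ F.Fh (ε , lookup ρ x)     ≈⟨ η-lookup ρ x ⟩
    ⟦ lookup ρ x ⟧ᵗ ∘ η Γ           ≈⟨ pullˡ (var∘tms ρ x) ⟨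
    ⟦ x ⟧ᵛ ∘ (⟦ ρ ⟧ˢ ∘ η Γ)         ∎

  η⁻¹ : ∀ Γ → Hom ⟦ Γ ⟧ᶜ (F.Fo Γ)
  η⁻¹ ε = F.𝟙-inv
  η⁻¹ (Γ ▷ σ) = F.×-inv {Γ} {ε ▷ σ} ∘ ⟨ η⁻¹ Γ ∘ weaken Γ σ , θ⁻¹ σ ∘ ⟦ here {Γ = Γ} ⟧ᵛ ⟩

  Fvar∘η⁻¹ : ∀ Γ {σ} (x : Γ ∋ σ) → Fvar x ∘ η⁻¹ Γ ≈ θ⁻¹ σ ∘ ⟦ x ⟧ᵛ
  Fvar∘η⁻¹ (Γ ▷ σ) here = ≈-trans (Fvar-here∘×-inv _) (π₂-β _ _)
  Fvar∘η⁻¹ (Γ ▷ τ) {σ} (there y) = begin⟨ homSetoid ⟩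
    Fvar (there y) ∘ η⁻¹ (Γ ▷ τ)                                          ≈⟨ Fvar-there∘×-inv y _ ⟩
    Fvar y ∘ (π₁ ∘ ⟨ η⁻¹ Γ ∘ weaken Γ τ , θ⁻¹ τ ∘ ⟦ here {Γ = Γ} ⟧ᵛ ⟩)   ≈⟨ refl⟩∘⟨ π₁-β _ _ ⟩
    Fvar y ∘ (η⁻¹ Γ ∘ weaken Γ τ)                                         ≈⟨ pullˡ (Fvar∘η⁻¹ Γ y) ⟩
    (θ⁻¹ σ ∘ ⟦ y ⟧ᵛ) ∘ weaken Γ τ                                         ≈⟨ pullʳ (var∘weaken y) ⟩
    θ⁻¹ σ ∘ ⟦ there y ⟧ᵛ                                                  ∎

  η∘η⁻¹ : ∀ Γ → η Γ ∘ η⁻¹ Γ ≈ id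
  η∘η⁻¹ Γ = vars-jointly-monic Γ _ _ λ {σ} x → begin⟨ homSetoid ⟩
    ⟦ x ⟧ᵛ ∘ (η Γ ∘ η⁻¹ Γ)     ≈⟨ pullˡ (var∘η Γ x) ⟩
    (θ σ ∘ Fvar x) ∘ η⁻¹ Γ     ≈⟨ pullʳ (Fvar∘η⁻¹ Γ x) ⟩
    θ σ ∘ (θ⁻¹ σ ∘ ⟦ x ⟧ᵛ)     ≈⟨ pullˡ (θ∘θ⁻¹ σ) ⟩
    id ∘ ⟦ x ⟧ᵛ                ≈⟨ idˡ _ ⟩
    ⟦ x ⟧ᵛ                     ≈⟨ idʳ _ ⟨
    ⟦ x ⟧ᵛ ∘ id                ∎

  η⁻¹∘η : ∀ Γ → η⁻¹ Γ ∘ η Γ ≈ id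
  η⁻¹∘η Γ = Fvars-jointly-monic Γ _ _ λ {σ} v → begin⟨ homSetoid ⟩
    Fvar v ∘ (η⁻¹ Γ ∘ η Γ)     ≈⟨ pullˡ (Fvar∘η⁻¹ Γ v) ⟩
    (θ⁻¹ σ ∘ ⟦ v ⟧ᵛ) ∘ η Γ     ≈⟨ pullʳ (var∘η Γ v) ⟩
    θ⁻¹ σ ∘ (θ σ ∘ Fvar v)     ≈⟨ pullˡ (θ⁻¹∘θ σ) ⟩
    id ∘ Fvar v                ≈⟨ idˡ _ ⟩
    Fvar v                     ≈⟨ idʳ _ ⟨
    Fvar v ∘ id                ∎

  η-canon : ∀ Γ σ → η (Γ ▷ σ) ∘ (F.×-inv {Γ} {ε ▷ σ} ∘ (id ⊠m θ⁻¹ σ)) ≈ canon S Γ σ ∘ (η Γ ⊠m id)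
  η-canon Γ σ = vars-jointly-monic (Γ ▷ σ) _ _ componentwise
    where
    k = id ⊠m θ⁻¹ σ
    componentwise : ∀ {τ} (x : (Γ ▷ σ) ∋ τ)
                    → ⟦ x ⟧ᵛ ∘ (η (Γ ▷ σ) ∘ (F.×-inv ∘ k)) ≈ ⟦ x ⟧ᵛ ∘ (canon S Γ σ ∘ (η Γ ⊠m id))
    componentwise here = begin⟨ homSetoid ⟩
      ⟦ here {Γ = Γ} ⟧ᵛ ∘ (η (Γ ▷ σ) ∘ (F.×-inv ∘ k))   ≈⟨ pullˡ (var∘η (Γ ▷ σ) here) ⟩
      (θ σ ∘ Fvar {Γ ▷ σ} here) ∘ (F.×-inv ∘ k)      ≈⟨ pullʳ (Fvar-here∘×-inv k) ⟩
      θ σ ∘ (π₂ ∘ k)                                 ≈⟨ refl⟩∘⟨ π₂-β _ _ ⟩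
      θ σ ∘ (θ⁻¹ σ ∘ π₂)                             ≈⟨ pullˡ (θ∘θ⁻¹ σ) ⟩
      id ∘ π₂                                        ≈⟨ π₂-β _ _ ⟨
      π₂ ∘ (η Γ ⊠m id)                               ≈⟨ pullˡ (canon-here Γ σ) ⟨
      ⟦ here {Γ = Γ} ⟧ᵛ ∘ (canon S Γ σ ∘ (η Γ ⊠m id))   ∎
    componentwise {τ} (there y) = begin⟨ homSetoid ⟩
      ⟦ there {τ = σ} y ⟧ᵛ ∘ (η (Γ ▷ σ) ∘ (F.×-inv ∘ k))   ≈⟨ pullˡ (var∘η (Γ ▷ σ) (there y)) ⟩
      (θ τ ∘ Fvar (there {τ = σ} y)) ∘ (F.×-inv ∘ k)    ≈⟨ pullʳ (Fvar-there∘×-inv y k) ⟩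
      θ τ ∘ (Fvar y ∘ (π₁ ∘ k))                         ≈⟨ refl⟩∘⟨ refl⟩∘⟨ ≈-trans (π₁-β _ _) (idˡ π₁) ⟩
      θ τ ∘ (Fvar y ∘ π₁)                               ≈⟨ sym-assoc _ _ _ ⟩
      (θ τ ∘ Fvar y) ∘ π₁                               ≈⟨ var∘η Γ y ⟩∘⟨refl ⟨
      (⟦ y ⟧ᵛ ∘ η Γ) ∘ π₁                               ≈⟨ ≈-trans (∘-assoc _ _ _) (refl⟩∘⟨ ≈-sym (π₁-β _ _)) ⟩
      ⟦ y ⟧ᵛ ∘ (π₁ ∘ (η Γ ⊠m id))                       ≈⟨ sym-assoc _ _ _ ⟩
      (⟦ y ⟧ᵛ ∘ π₁) ∘ (η Γ ⊠m id)                       ≈⟨ canon-there Γ σ y ⟩∘⟨refl ⟨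
      (⟦ there {τ = σ} y ⟧ᵛ ∘ canon S Γ σ) ∘ (η Γ ⊠m id)   ≈⟨ ∘-assoc _ _ _ ⟩
      ⟦ there {τ = σ} y ⟧ᵛ ∘ (canon S Γ σ ∘ (η Γ ⊠m id))   ∎

  η-pair : ∀ {Γ σ} (M N : Tm Γ σ)
           → ((θ σ ⊠m θ σ) ∘ ⟨ F.Fh (π₁S {ε ▷ σ} {ε ▷ σ}) , F.Fh (π₂S {ε ▷ σ} {ε ▷ σ}) ⟩) ∘ F.Fh ((ε , M) , N)
             ≈ ⟨ ⟦ M ⟧ᵗ , ⟦ N ⟧ᵗ ⟩ ∘ η Γ
  η-pair {Γ} {σ} M N = begin⟨ homSetoid ⟩
    ((θ σ ⊠m θ σ) ∘ Pr) ∘ F.Fh ((ε , M) , N)                   ≈⟨ ≈-trans (∘-assoc _ _ _) (⟨⟩∘ _ _ _) ⟩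
    ⟨ (θ σ ∘ π₁) ∘ (Pr ∘ F.Fh ((ε , M) , N)) , (θ σ ∘ π₂) ∘ (Pr ∘ F.Fh ((ε , M) , N)) ⟩
      ≈⟨ ⟨⟩-cong₂ (≈-trans (pullʳ (pullˡ (π₁-β _ _))) (≈-trans (refl⟩∘⟨ ≈-sym (F.Fh-∘ _ _)) (η-tm M)))
                  (≈-trans (pullʳ (pullˡ (π₂-β _ _))) (≈-trans (refl⟩∘⟨ ≈-sym (F.Fh-∘ _ _)) (η-tm N))) ⟩
    ⟨ ⟦ M ⟧ᵗ ∘ η Γ , ⟦ N ⟧ᵗ ∘ η Γ ⟩                            ≈⟨ ⟨⟩∘ _ _ _ ⟨
    ⟨ ⟦ M ⟧ᵗ , ⟦ N ⟧ᵗ ⟩ ∘ η Γ                                  ∎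
    where
    Pr = ⟨ F.Fh (π₁S {ε ▷ σ} {ε ▷ σ}) , F.Fh (π₂S {ε ▷ σ} {ε ▷ σ}) ⟩

  mutual
    η-fm : ∀ {Γ} (φ : Fm Γ) → F.Fp φ ≃ Pmap (η Γ) ⟦ φ ⟧ᶠ
    η-fm {Γ} (rel {Δ = Δ} R ts) = begin⟨ predSetoid ⟩
      F.Fp (rel R ts)
        ≈⟨ ≡⇒≃ (cong (λ us → F.Fp (rel R us)) (sym (genericVars-reindexᴳ ts))) ⟩
      F.Fp (subF (reindexᴳ ts) (rel R (genericVars Δ)))           ≈⟨ F.Fp-nat (reindexᴳ ts) _ ⟩
      Pmap (F.Fh (reindexᴳ ts)) (F.Fp (rel R (genericVars Δ)))     ≈⟨ Pmap-resp (F-reindexᴳ ts) _ ⟩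
      Pmap (ξ Δ ∘ (⟦ ts ⟧ˢ ∘ η Γ)) (F.Fp (rel R (genericVars Δ)))  ≈⟨ Pmap-∘ _ _ _ ⟩
      Pmap (⟦ ts ⟧ˢ ∘ η Γ) (Pmap (ξ Δ) (F.Fp (rel R (genericVars Δ))))
        ≈⟨ Pmap-cong _ (ξ-generic-rel R) ⟩
      Pmap (⟦ ts ⟧ˢ ∘ η Γ) (relI R)                                ≈⟨ Pmap-∘ _ _ _ ⟩
      Pmap (η Γ) (Pmap ⟦ ts ⟧ˢ (relI R))                           ∎
    η-fm {Γ} (eq σ M N) = begin⟨ predSetoid ⟩
      F.Fp (subF ((ε , M) , N) (eqFm (ε ▷ σ)))                       ≈⟨ F.Fp-nat _ _ ⟩
      Pmap (F.Fh ((ε , M) , N)) (F.Fp (eqFm (ε ▷ σ)))                ≈⟨ Pmap-cong _ (F.Fp-Eq (ε ▷ σ)) ⟩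
      Pmap (F.Fh ((ε , M) , N)) (Pmap Pr (Eq (F.Fo (ε ▷ σ))))
        ≈⟨ Pmap-cong _ (Pmap-cong _ (Eq-idToHom (sortEq σ))) ⟩
      Pmap (F.Fh ((ε , M) , N)) (Pmap Pr (Pmap (θ σ ⊠m θ σ) (Eq (sortI σ))))
        ≈⟨ ≃-trans (Pmap-cong _ (≃-sym (Pmap-∘ _ _ _))) (≃-sym (Pmap-∘ _ _ _)) ⟩
      Pmap (((θ σ ⊠m θ σ) ∘ Pr) ∘ F.Fh ((ε , M) , N)) (Eq (sortI σ)) ≈⟨ Pmap-resp (η-pair M N) _ ⟩
      Pmap (⟨ ⟦ M ⟧ᵗ , ⟦ N ⟧ᵗ ⟩ ∘ η Γ) (Eq (sortI σ))                  ≈⟨ Pmap-∘ _ _ _ ⟩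
      Pmap (η Γ) (Pmap ⟨ ⟦ M ⟧ᵗ , ⟦ N ⟧ᵗ ⟩ (Eq (sortI σ)))             ∎
      where
      Pr = ⟨ F.Fh (π₁S {ε ▷ σ} {ε ▷ σ}) , F.Fh (π₂S {ε ▷ σ} {ε ▷ σ}) ⟩
    η-fm {Γ} (conn k φs) =
      ≃-trans (F.Fp-op k φs) (≃-trans (op-resp k (η-fms φs)) (≃-sym (op-nat k (η Γ) (fmIs S φs))))
    η-fm {Γ} (quant q σ φ) = begin⟨ predSetoid ⟩
      F.Fp (quantAll q (ε ▷ σ) φ)
        ≈⟨ F.Fp-Ω q Γ (ε ▷ σ) φ ⟩
      Ω q (F.Fo Γ) (F.Fo (ε ▷ σ)) (Pmap F.×-inv (F.Fp φ))
        ≈⟨ Ω-resp q _ _ (Pmap-cong _ (η-fm φ)) ⟩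
      Ω q (F.Fo Γ) (F.Fo (ε ▷ σ)) (Pmap F.×-inv (Pmap (η (Γ ▷ σ)) ⟦ φ ⟧ᶠ))
        ≈⟨ Ω-idToHom q (F.Fo Γ) (sortEq σ) _ ⟩
      Ω q (F.Fo Γ) (sortI σ) (Pmap (id ⊠m θ⁻¹ σ) (Pmap F.×-inv (Pmap (η (Γ ▷ σ)) ⟦ φ ⟧ᶠ)))
        ≈⟨ Ω-resp q _ _ (≃-trans (Pmap-cong _ (≃-sym (Pmap-∘ _ _ _))) (≃-sym (Pmap-∘ _ _ _))) ⟩
      Ω q (F.Fo Γ) (sortI σ) (Pmap ((η (Γ ▷ σ) ∘ F.×-inv) ∘ (id ⊠m θ⁻¹ σ)) ⟦ φ ⟧ᶠ)
        ≈⟨ Ω-resp q _ _ (≃-trans (Pmap-resp (≈-trans (∘-assoc _ _ _) (η-canon Γ σ)) _) (Pmap-∘ _ _ _)) ⟩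
      Ω q (F.Fo Γ) (sortI σ) (Pmap (η Γ ⊠m id) (Pmap (canon S Γ σ) ⟦ φ ⟧ᶠ))
        ≈⟨ Ω-nat q (sortI σ) (η Γ) _ ⟨
      Pmap (η Γ) (Ω q ⟦ Γ ⟧ᶜ (sortI σ) (Pmap (canon S Γ σ) ⟦ φ ⟧ᶠ)) ∎

    η-fms : ∀ {Γ n} (φs : Vec (Fm Γ) n) → Pointwise _≃_ (Vec.map F.Fp φs) (Vec.map (Pmap (η Γ)) (fmIs S φs))
    η-fms [] = []
    η-fms (φ ∷ φs) = η-fm φ ∷ η-fms φs

  -- The model hypothesis is needed only to form the interpretation functor.
  F≅interpretation : (S⊨T : Interp.IsModel ℒ Sg (FA.raw X) S T)
                     → TwoIso F (Existence.interpretation ℒ L adq Sg T isT X S S⊨T)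
  F≅interpretation _ = record
    { η      = η
    ; η-nat  = η-natural
    ; η-p    = η-fm
    ; η-inv  = η⁻¹
    ; η-iso₁ = η⁻¹∘η
    ; η-iso₂ = η∘η⁻¹
    }

mainTheorem6 : (ℒ : Language) (L : Logic ℒ) (adq : Adequate ℒ L)
               (Sg : Signature) (T : Syntax.Theory ℒ Sg) (isT : IsLTheory ℒ L Sg T)
               {o h e p r : Level} (X : FA ℒ o h e p r)
               (S : Interp.Structure ℒ Sg (FA.raw X))
               → Interp.IsModel ℒ Sg (FA.raw X) S T
               → Σ (FAMor (CT ℒ L adq Sg T isT) X) (λ Sbar →
                   Interp.StrEq ℒ Sg (FA.raw X) (applyS Sbar (generic ℒ Sg T)) S
                   × ((F : FAMor (CT ℒ L adq Sg T isT) X)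
                      → Interp.StrEq ℒ Sg (FA.raw X) (applyS F (generic ℒ Sg T)) S
                      → TwoIso F Sbar))
mainTheorem6 ℒ L adq Sg T isT X S S⊨T =
  interpretation , interpretation-generic ,
  λ F F[G]≡S → Uniqueness.F≅interpretation ℒ L adq Sg T isT X S F F[G]≡S S⊨T
  where open Existence ℒ L adq Sg T isT X S S⊨T
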